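{- Let $G$ be an $(n,m)$-superconcentrator of depth $d$ and let $\mathbb F$ be a finite field. Let $C_G:\mathbb F^n\to\mathbb F^m$ be the arithmetic circuit obtained from $G$ by replacing each non-input vertex with an addition gate, where each edge $e$ carries a coefficient $r_e\in\mathbb F$ chosen independently and uniformly at random and each gate computes $\sum r_{(u,v)}\cdot(\text{value of }u)$ over its incoming edges $(u,v)$. Then with probability at least $$1-\sum_{i=1}^n\binom ni\binom mi\frac{di}{|\mathbb F|},$$ $C_G$ encodes a superconcentrator-induced code.
   Context: A directed acyclic graph with $n$ input vertices (sources, identified with the input variables) and $m$ designated output vertices is an $(n,m)$-superconcentrator if for every set $X$ of inputs and set $Y$ of outputs with $|X|=|Y|$ the maximum number of vertex-disjoint paths from $X$ to $Y$ equals $|X|$. Its depth is the maximum number of edges on an input-output path. A map $C:\mathbb F^n\to\mathbb F^m$ is a superconcentrator-induced code if $\mathrm{dist}(C(x),C(y))\ge m-\mathrm{dist}(x,y)+1$ for all distinct $x,y\in\mathbb F^n$, where $\mathrm{dist}$ is Hamming distance. -}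

module Defs where

open import Level using (0ℓ)
open import Data.Nat using (ℕ; zero; suc; _≤_; _<_)
import Data.Nat as ℕ
open import Data.Fin using (Fin; toℕ)
import Data.Fin as F
open import Data.Fin.Subset using (Subset; _∈_)
import Data.Fin.Subset
import Data.Maybe
import Data.Vec as Vec
open import Data.List using (List; []; _∷_)
import Data.List.Membership.Propositional as LM
open import Data.Vec using (Vec; tabulate; lookup)
open import Data.Product using (Σ; ∃; _×_; _,_)
open import Data.Sum using (_⊎_)
open import Data.Maybe using (Maybe; just; nothing)
open import Data.Empty using (⊥)
open import Relation.Nullary using (¬_; yes; no)
open import Relation.Binary.PropositionalEquality using (_≡_; _≢_)
open import Relation.Binary.Definitions using (DecidableEquality)
open import Algebra.Structures using (IsCommutativeRing)
open import Function.Bundles using (_↔_)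
open import Function.Definitions using (Injective)

record FiniteField : Set₁ where
  infixl 7 _*_
  infixl 6 _+_
  field
    Carrier           : Set
    _+_ _*_           : Carrier → Carrier → Carrier
    -_                : Carrier → Carrier
    0# 1#             : Carrier
    isCommutativeRing : IsCommutativeRing _≡_ _+_ _*_ -_ 0# 1#
    0≢1               : 0# ≢ 1#
    inverse           : ∀ x → x ≢ 0# → ∃ λ y → x * y ≡ 1#
    _≟_               : DecidableEquality Carrier
    size              : ℕ
    enum              : Fin size ↔ Carrier

record Graph (n m : ℕ) : Set where
  field
    N      : ℕ
    E      : ℕ
    src    : Fin E → Fin N
    tgt    : Fin E → Fin N
    inp    : Fin n → Fin N
    out    : Fin m → Fin N
    inp-inj : Injective _≡_ _≡_ inp
    out-inj : Injective _≡_ _≡_ out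

module _ {n m : ℕ} (G : Graph n m) where
  open Graph G

  data Path : Fin N → Fin N → Set where
    stop : ∀ v → Path v v
    step : ∀ (e : Fin E) {w} → Path (tgt e) w → Path (src e) w

  len : ∀ {u v} → Path u v → ℕ
  len (stop _)   = 0
  len (step _ p) = suc (len p)

  vertices : ∀ {u v} → Path u v → List (Fin N)
  vertices (stop v)          = v ∷ []
  vertices (step e {w} p)    = src e ∷ vertices p

  Acyclic : Set
  Acyclic = ∀ v (p : Path v v) → len p ≡ 0

  InputsAreSources : Set
  InputsAreSources = ∀ i e → tgt e ≢ inp i

  IsDAG : Set
  IsDAG = Acyclic × InputsAreSources

  record DisjointPaths (X : Subset n) (Y : Subset m) (k : ℕ) : Set where
    field
      s    : Fin k → Fin n
      t    : Fin k → Fin m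
      s∈X  : ∀ j → s j ∈ X
      t∈Y  : ∀ j → t j ∈ Y
      path : ∀ j → Path (inp (s j)) (out (t j))
      disj : ∀ j j' → j ≢ j' → ∀ v →
             v LM.∈ vertices (path j) → v LM.∈ vertices (path j') → ⊥

  MaxDisjoint : Subset n → Subset m → ℕ → Set
  MaxDisjoint X Y k =
    DisjointPaths X Y k × (∀ k' → DisjointPaths X Y k' → k' ≤ k)

  IsSuperconcentrator : Set
  IsSuperconcentrator =
    IsDAG × (∀ (X : Subset n) (Y : Subset m) →
             Data.Fin.Subset.∣ X ∣ ≡ Data.Fin.Subset.∣ Y ∣ →
             MaxDisjoint X Y (Data.Fin.Subset.∣ X ∣))

  -- depth = maximum number of edges on an input-output path (0 if none)
  HasDepth : ℕ → Set
  HasDepth d =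
    (∀ i j (p : Path (inp i) (out j)) → len p ≤ d) ×
    (d ≡ 0 ⊎ ∃ λ i → ∃ λ j → Σ (Path (inp i) (out j)) λ p → len p ≡ d)

module _ (𝔽 : FiniteField) where
  open FiniteField 𝔽

  dist : ∀ {k} → Vec Carrier k → Vec Carrier k → ℕ
  dist Vec.[] Vec.[] = 0
  dist (a Vec.∷ xs) (b Vec.∷ ys) with a ≟ b
  ... | yes _ = dist xs ys
  ... | no  _ = suc (dist xs ys)

  -- dist(C x, C y) ≥ m − dist(x,y) + 1, written without truncated subtraction
  IsSICode : ∀ {n m} → (Vec Carrier n → Vec Carrier m) → Set
  IsSICode {n} {m} C =
    ∀ x y → x ≢ y → suc m ≤ dist (C x) (C y) ℕ.+ dist x y

  module _ {n m : ℕ} (G : Graph n m) where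
    open Graph G

    findInput : ∀ {k} → (Fin k → Fin N) → Fin N → Maybe (Fin k)
    findInput {zero}  f v = nothing
    findInput {suc k} f v with f F.zero F.≟ v
    ... | yes _ = just F.zero
    ... | no  _ = Data.Maybe.map F.suc (findInput (λ i → f (F.suc i)) v)

    sumInto : ∀ {k} → (Fin k → Fin E) → Fin N → (Fin k → Carrier) → Carrier
    sumInto {zero}  _ v g = 0#
    sumInto {suc k} es v g with tgt (es F.zero) F.≟ v
    ... | yes _ = g F.zero + sumInto (λ i → es (F.suc i)) v (λ i → g (F.suc i))
    ... | no  _ = sumInto (λ i → es (F.suc i)) v (λ i → g (F.suc i))

    -- value of vertex v, evaluated with `fuel` levels of recursion;
    -- for an acyclic G, fuel = N (number of vertices) gives the exact value.
    value : Vec Carrier E → Vec Carrier n → ℕ → Fin N → Carrier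
    value r x fuel v with findInput inp v
    value r x fuel       v | just i  = lookup x i
    value r x zero       v | nothing = 0#
    value r x (suc fuel) v | nothing =
      sumInto (λ e → e) v (λ e → lookup r e * value r x fuel (src e))

    circuit : Vec Carrier E → Vec Carrier n → Vec Carrier m
    circuit r x = tabulate λ j → value r x N (out j)

{-# OPTIONS --safe #-}

-- Fix input and output sets X, Y of equal size k, and k vertex-disjoint paths from s_b ∈ X to
-- t_b ∈ Y. Let M(r) be the k × k matrix whose (a, b) entry is output t_a of the circuit on the
-- unit input at s_b. Its entries are polynomials of degree ≤ d in the edge coefficients r, so
-- det M is a polynomial of degree ≤ dk; when r is the indicator of the path edges, M is the
-- identity. By Schwartz–Zippel, det M(r) = 0 for at most a dk/|F| fraction of all r, and the
-- union bound over all pairs (X, Y) bounds the bad r. For every other r the circuit is a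
-- superconcentrator-induced code: if x ≠ y and dist(C x, C y) + dist(x, y) ≤ m, take X where x
-- and y differ and Y a set of |X| outputs where C x and C y agree; by linearity of the circuit,
-- (x - y) restricted to X is a nonzero kernel vector of M(r).

module Submission where

open import Defs
import Algebra.Bundles
import Data.Nat
import Data.Fin.Subset
open import Data.List using (List)

-- Algebra.Solver.Ring needs coefficients with decidable equality mapped homomorphically into R.
module IntegerCoefficients {c ℓ} (R : Algebra.Bundles.CommutativeRing c ℓ) where

  open import Algebra.Solver.Ring.AlmostCommutativeRing
    using (fromCommutativeRing; _-Raw-AlmostCommutative⟶_)
  open import Data.Integer as ℤ using (ℤ; +_; -[1+_]; _⊖_)
  import Data.Integer.Properties as ℤ
  open import Data.Maybe using (Maybe; just; nothing)
  open import Data.Nat as ℕ using (zero; suc)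
  import Data.Nat.Properties as ℕ
  open import Data.Sign as Sign using (Sign)
  open import Relation.Binary.PropositionalEquality as ≡ using (_≡_; cong)
  open import Relation.Nullary using (yes; no)

  open Algebra.Bundles.CommutativeRing R
  open import Algebra.Properties.Ring ring
    using (-‿involutive; -0#≈0#; -‿+-comm; -‿distribˡ-*; -‿distribʳ-*)
  open import Algebra.Properties.Semiring.Mult semiring
    using (_×_; ×-homo-1; ×-homo-+; ×1-homo-*)
  open import Relation.Binary.Reasoning.Setoid setoid

  fromℤ : ℤ → Carrier
  fromℤ (+ n)    = n × 1#
  fromℤ -[1+ n ] = - (suc n × 1#)

  fromℤ-neg : ∀ z → fromℤ (ℤ.- z) ≈ - fromℤ z
  fromℤ-neg (+ zero)  = sym -0#≈0#
  fromℤ-neg (+ suc n) = refl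
  fromℤ-neg -[1+ n ]  = sym (-‿involutive _)

  private
    cancel-+ : ∀ a x y → (a + x) + - (a + y) ≈ x + - y
    cancel-+ a x y = begin
      (a + x) + - (a + y)   ≈⟨ +-congˡ (sym (-‿+-comm a y)) ⟩
      (a + x) + (- a + - y) ≈⟨ +-congʳ (+-comm a x) ⟩
      (x + a) + (- a + - y) ≈⟨ +-assoc x a _ ⟩
      x + (a + (- a + - y)) ≈⟨ +-congˡ (sym (+-assoc a (- a) (- y))) ⟩
      x + ((a + - a) + - y) ≈⟨ +-congˡ (+-congʳ (-‿inverseʳ a)) ⟩
      x + (0# + - y)        ≈⟨ +-congˡ (+-identityˡ (- y)) ⟩
      x + - y               ∎

  fromℤ-⊖ : ∀ m n → fromℤ (m ⊖ n) ≈ m × 1# + - (n × 1#)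
  fromℤ-⊖ m       zero    = begin
    fromℤ (m ⊖ 0)        ≡⟨ cong fromℤ (ℤ.⊖-≥ {m} ℕ.z≤n) ⟩
    m × 1#               ≈⟨ sym (+-identityʳ _) ⟩
    m × 1# + 0#          ≈⟨ +-congˡ (sym -0#≈0#) ⟩
    m × 1# + - 0#        ∎
  fromℤ-⊖ zero    (suc n) = sym (+-identityˡ _)
  fromℤ-⊖ (suc m) (suc n) = begin
    fromℤ (suc m ⊖ suc n)             ≡⟨ cong fromℤ (ℤ.[1+m]⊖[1+n]≡m⊖n m n) ⟩
    fromℤ (m ⊖ n)                     ≈⟨ fromℤ-⊖ m n ⟩
    m × 1# + - (n × 1#)               ≈⟨ sym (cancel-+ 1# _ _) ⟩
    suc m × 1# + - (suc n × 1#)       ∎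

  fromℤ-+ : ∀ a b → fromℤ (a ℤ.+ b) ≈ fromℤ a + fromℤ b
  fromℤ-+ -[1+ m ] -[1+ n ] = begin
    - (suc (suc (m ℕ.+ n)) × 1#)      ≡⟨ cong (λ k → - (suc k × 1#)) (≡.sym (ℕ.+-suc m n)) ⟩
    - ((suc m ℕ.+ suc n) × 1#)        ≈⟨ -‿cong (×-homo-+ 1# (suc m) (suc n)) ⟩
    - (suc m × 1# + suc n × 1#)       ≈⟨ sym (-‿+-comm _ _) ⟩
    - (suc m × 1#) + - (suc n × 1#)   ∎
  fromℤ-+ -[1+ m ] (+ n)    = trans (fromℤ-⊖ n (suc m)) (+-comm _ _)
  fromℤ-+ (+ m)    -[1+ n ] = fromℤ-⊖ m (suc n)
  fromℤ-+ (+ m)    (+ n)    = ×-homo-+ 1# m n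

  private
    signed : Sign → Carrier → Carrier
    signed Sign.+ x = x
    signed Sign.- x = - x

    fromℤ-◃ : ∀ s n → fromℤ (s ℤ.◃ n) ≈ signed s (n × 1#)
    fromℤ-◃ Sign.+ n = reflexive (cong fromℤ (ℤ.+◃n≡+n n))
    fromℤ-◃ Sign.- n = trans (reflexive (cong fromℤ (ℤ.-◃n≡-n n))) (fromℤ-neg (+ n))

    fromℤ-signAbs : ∀ a → fromℤ a ≈ signed (ℤ.sign a) (ℤ.∣ a ∣ × 1#)
    fromℤ-signAbs (+ n)    = refl
    fromℤ-signAbs -[1+ n ] = refl

    signed-* : ∀ s t x y → signed (s Sign.* t) (x * y) ≈ signed s x * signed t y
    signed-* Sign.+ Sign.+ x y = refl
    signed-* Sign.+ Sign.- x y = -‿distribʳ-* x y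
    signed-* Sign.- Sign.+ x y = -‿distribˡ-* x y
    signed-* Sign.- Sign.- x y = begin
      x * y         ≈⟨ sym (-‿involutive _) ⟩
      - - (x * y)   ≈⟨ -‿cong (-‿distribˡ-* x y) ⟩
      - (- x * y)   ≈⟨ -‿distribʳ-* (- x) y ⟩
      - x * - y     ∎

  fromℤ-* : ∀ a b → fromℤ (a ℤ.* b) ≈ fromℤ a * fromℤ b
  fromℤ-* a b = begin
    fromℤ (a ℤ.* b)                                ≈⟨ fromℤ-◃ (s Sign.* t) (∣a∣ ℕ.* ∣b∣) ⟩
    signed (s Sign.* t) ((∣a∣ ℕ.* ∣b∣) × 1#)       ≈⟨ signed-cong (s Sign.* t) (×1-homo-* ∣a∣ ∣b∣) ⟩
    signed (s Sign.* t) ((∣a∣ × 1#) * (∣b∣ × 1#))  ≈⟨ signed-* s t _ _ ⟩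
    signed s (∣a∣ × 1#) * signed t (∣b∣ × 1#)      ≈⟨ sym (*-cong (fromℤ-signAbs a) (fromℤ-signAbs b)) ⟩
    fromℤ a * fromℤ b                              ∎
    where
    s = ℤ.sign a
    t = ℤ.sign b
    ∣a∣ = ℤ.∣ a ∣
    ∣b∣ = ℤ.∣ b ∣
    signed-cong : ∀ s {x y} → x ≈ y → signed s x ≈ signed s y
    signed-cong Sign.+ x≈y = x≈y
    signed-cong Sign.- x≈y = -‿cong x≈y

  fromℤ-homomorphism : ℤ.+-*-rawRing -Raw-AlmostCommutative⟶ fromCommutativeRing R
  fromℤ-homomorphism = record
    { ⟦_⟧ = fromℤ ; +-homo = fromℤ-+ ; *-homo = fromℤ-* ; -‿homo = fromℤ-neg
    ; 0-homo = refl ; 1-homo = ×-homo-1 1# }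

  fromℤ-≟ : ∀ a b → Maybe (fromℤ a ≈ fromℤ b)
  fromℤ-≟ a b with a ℤ.≟ b
  ... | yes a≡b = just (reflexive (cong fromℤ a≡b))
  ... | no _    = nothing

  open import Algebra.Solver.Ring ℤ.+-*-rawRing (fromCommutativeRing R)
    fromℤ-homomorphism fromℤ-≟ public
    using (solve; _:=_; _:+_; _:*_; :-_; _:-_)

module Counting where

  open import Data.List using ([]; _∷_; _++_; map; concatMap; filter; length; cartesianProductWith)
  open import Data.List.Properties using (length-filter; filter-++; length-++; filter-none; length-map; map-++)
  open import Data.List.Membership.Propositional using (_∈_)
  open import Data.List.Relation.Unary.All as All using (All; []; _∷_)
  open import Data.List.Relation.Unary.Any as Any using (here; there; any?)
  open import Data.Nat using (ℕ; suc; _+_; _*_; _≤_; z≤n; s≤s)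
  open import Data.Nat.ListAction using (sum)
  open import Data.Nat.ListAction.Properties using (sum-++)
  open import Data.Nat.Properties
  open import Data.Nat.Tactic.RingSolver using (solve-∀)
  open import Function using (_∘_)
  open import Level using (0ℓ)
  open import Relation.Binary.PropositionalEquality
  open import Relation.Nullary using (yes; no; ¬_; _⊎-dec_; contradiction)
  open import Relation.Unary using (Pred; Decidable)
  open import Relation.Unary.Properties using (∁?)

  module _ {A : Set} where

    count : {P : Pred A 0ℓ} → Decidable P → List A → ℕ
    count P? xs = length (filter P? xs)

    module _ {P : Pred A 0ℓ} (P? : Decidable P) where

      count-++ : ∀ xs ys → count P? (xs ++ ys) ≡ count P? xs + count P? ys
      count-++ xs ys = trans (cong length (filter-++ P? xs ys)) (length-++ (filter P? xs))

      count≤length : ∀ xs → count P? xs ≤ length xs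
      count≤length = length-filter P?

      count+count-∁≡length : ∀ xs → count P? xs + count (∁? P?) xs ≡ length xs
      count+count-∁≡length []       = refl
      count+count-∁≡length (x ∷ xs) with P? x
      ... | yes _ = cong suc (count+count-∁≡length xs)
      ... | no  _ = trans (+-suc _ _) (cong suc (count+count-∁≡length xs))

    module _ {P Q : Pred A 0ℓ} (P? : Decidable P) (Q? : Decidable Q) where

      count-mono : ∀ xs → All (λ x → P x → Q x) xs → count P? xs ≤ count Q? xs
      count-mono []       []         = z≤n
      count-mono (x ∷ xs) (P⇒Q ∷ hs) with P? x | Q? x
      ... | yes p | yes _ = s≤s (count-mono xs hs)
      ... | yes p | no ¬q = contradiction (P⇒Q p) ¬q
      ... | no _  | yes _ = m≤n⇒m≤1+n (count-mono xs hs)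
      ... | no _  | no _  = count-mono xs hs

      count-⊎ : ∀ xs → count (λ x → P? x ⊎-dec Q? x) xs ≤ count P? xs + count Q? xs
      count-⊎ []       = z≤n
      count-⊎ (x ∷ xs) with P? x | Q? x
      ... | yes _ | yes _ = s≤s (≤-trans (count-⊎ xs) (+-monoʳ-≤ (count P? xs) (n≤1+n _)))
      ... | yes _ | no _  = s≤s (count-⊎ xs)
      ... | no _  | yes _ = ≤-trans (s≤s (count-⊎ xs)) (≤-reflexive (sym (+-suc _ _)))
      ... | no _  | no _  = count-⊎ xs

  module _ {A B : Set} {P : Pred B 0ℓ} (P? : Decidable P) where

    count-map : ∀ (f : A → B) xs → count P? (map f xs) ≡ count (P? ∘ f) xs
    count-map f []       = refl
    count-map f (x ∷ xs) with P? (f x)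
    ... | yes _ = cong suc (count-map f xs)
    ... | no  _ = count-map f xs

  module _ {A B C : Set} {P : Pred C 0ℓ} (P? : Decidable P) where

    count-cartesianProductWith : ∀ (f : A → B → C) xs ys →
      count P? (cartesianProductWith f xs ys) ≡ sum (map (λ x → count (P? ∘ f x) ys) xs)
    count-cartesianProductWith f []       ys = refl
    count-cartesianProductWith f (x ∷ xs) ys = begin
      count P? (map (f x) ys ++ cartesianProductWith f xs ys)
        ≡⟨ count-++ P? (map (f x) ys) _ ⟩
      count P? (map (f x) ys) + count P? (cartesianProductWith f xs ys)
        ≡⟨ cong₂ _+_ (count-map P? (f x) ys) (count-cartesianProductWith f xs ys) ⟩
      count (P? ∘ f x) ys + sum (map (λ x → count (P? ∘ f x) ys) xs) ∎
      where open ≡-Reasoning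

  length-cartesianProductWith : ∀ {A B C : Set} (f : A → B → C) xs ys →
    length (cartesianProductWith f xs ys) ≡ length xs * length ys
  length-cartesianProductWith f []       ys = refl
  length-cartesianProductWith f (x ∷ xs) ys = begin
    length (map (f x) ys ++ cartesianProductWith f xs ys)       ≡⟨ length-++ (map (f x) ys) ⟩
    length (map (f x) ys) + length (cartesianProductWith f xs ys)
      ≡⟨ cong₂ _+_ (length-map (f x) ys) (length-cartesianProductWith f xs ys) ⟩
    length ys + length xs * length ys                           ∎
    where open ≡-Reasoning

  module _ {A J : Set} {Q : J → Pred A 0ℓ} (Q? : ∀ j → Decidable (Q j)) where

    count-any≤sum : ∀ js xs →
      count (λ x → any? (λ j → Q? j x) js) xs ≤ sum (map (λ j → count (Q? j) xs) js)
    count-any≤sum []       xs = ≤-reflexive (cong length (filter-none _ (All.tabulate {xs = xs} (λ _ ()))))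
    count-any≤sum (j ∷ js) xs = begin
      count (λ x → any? (λ j → Q? j x) (j ∷ js)) xs
        ≤⟨ count-mono _ (λ x → Q? j x ⊎-dec any? (λ j → Q? j x) js) xs (All.tabulate λ _ → Any.toSum) ⟩
      count (λ x → Q? j x ⊎-dec any? (λ j → Q? j x) js) xs
        ≤⟨ count-⊎ (Q? j) (λ x → any? (λ j → Q? j x) js) xs ⟩
      count (Q? j) xs + count (λ x → any? (λ j → Q? j x) js) xs
        ≤⟨ +-monoʳ-≤ (count (Q? j) xs) (count-any≤sum js xs) ⟩
      count (Q? j) xs + sum (map (λ j → count (Q? j) xs) js) ∎
      where open ≤-Reasoning

  module _ {A : Set} where

    sum-map-mono : ∀ {f g : A → ℕ} xs → (∀ {x} → x ∈ xs → f x ≤ g x) → sum (map f xs) ≤ sum (map g xs)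
    sum-map-mono []       f≤g = z≤n
    sum-map-mono (x ∷ xs) f≤g = +-mono-≤ (f≤g (here refl)) (sum-map-mono xs (f≤g ∘ there))

    sum-map-*ʳ : ∀ (f : A → ℕ) c xs → sum (map f xs) * c ≡ sum (map (λ x → f x * c) xs)
    sum-map-*ʳ f c []       = refl
    sum-map-*ʳ f c (x ∷ xs) = trans (*-distribʳ-+ c (f x) _) (cong (f x * c +_) (sum-map-*ʳ f c xs))

    sum-map-const : ∀ {f : A → ℕ} {c} xs → (∀ {x} → x ∈ xs → f x ≡ c) → sum (map f xs) ≡ length xs * c
    sum-map-const []       f≡c = refl
    sum-map-const (x ∷ xs) f≡c = cong₂ _+_ (f≡c (here refl)) (sum-map-const xs (f≡c ∘ there))

    sum-map-concatMap : ∀ {B : Set} (g : B → ℕ) (f : A → List B) xs →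
      sum (map g (concatMap f xs)) ≡ sum (map (λ x → sum (map g (f x))) xs)
    sum-map-concatMap g f []       = refl
    sum-map-concatMap g f (x ∷ xs) = begin
      sum (map g (f x ++ concatMap f xs))            ≡⟨ cong sum (map-++ g (f x) _) ⟩
      sum (map g (f x) ++ map g (concatMap f xs))    ≡⟨ sum-++ (map g (f x)) _ ⟩
      sum (map g (f x)) + sum (map g (concatMap f xs)) ≡⟨ cong (sum (map g (f x)) +_) (sum-map-concatMap g f xs) ⟩
      sum (map g (f x)) + sum (map (λ x → sum (map g (f x))) xs) ∎
      where open ≡-Reasoning

    sum-map-≤-count : ∀ {P : Pred A 0ℓ} (P? : Decidable P) {f : A → ℕ} {a b} →
      (∀ x → P x → f x ≤ a) → (∀ x → ¬ P x → f x ≤ b) →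
      ∀ xs → sum (map f xs) ≤ a * count P? xs + b * count (∁? P?) xs
    sum-map-≤-count P? ≤a ≤b [] = z≤n
    sum-map-≤-count P? {a = a} {b} ≤a ≤b (x ∷ xs) with P? x
    ... | yes p = ≤-trans (+-mono-≤ (≤a x p) (sum-map-≤-count P? ≤a ≤b xs))
                          (≤-reflexive (shuffle a (count P? xs) b (count (∁? P?) xs)))
      where
      shuffle : ∀ a c b c′ → a + (a * c + b * c′) ≡ a * suc c + b * c′
      shuffle = solve-∀
    ... | no ¬p = ≤-trans (+-mono-≤ (≤b x ¬p) (sum-map-≤-count P? ≤a ≤b xs))
                          (≤-reflexive (shuffle a (count P? xs) b (count (∁? P?) xs)))
      where
      shuffle : ∀ a c b c′ → b + (a * c + b * c′) ≡ a * c + b * suc c′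
      shuffle = solve-∀

module Vectors {A : Set} (xs : List A) where

  open import Data.List using ([]; _∷_; map; length; cartesianProductWith)
  import Data.List.Relation.Unary.All as All
  open import Data.List.Relation.Unary.AllPairs using ([]; _∷_)
  open import Data.List.Relation.Unary.Any using (here)
  open import Data.List.Relation.Unary.Unique.Propositional using (Unique)
  import Data.List.Relation.Unary.Unique.Propositional.Properties as Unique
  open import Data.List.Membership.Propositional using (_∈_)
  open import Data.List.Membership.Propositional.Properties using (∈-cartesianProductWith⁺)
  open import Data.Nat using (ℕ; zero; suc; _*_; _^_)
  open import Data.Nat.ListAction using (sum)
  open import Data.Nat.Properties using (*-comm)
  open import Data.Product using (_,_)
  open import Data.Vec using (Vec; []; _∷_)
  open import Data.Vec.Properties using (∷-injectiveˡ; ∷-injectiveʳ)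
  open import Level using (0ℓ)
  open import Relation.Binary.PropositionalEquality
  open import Relation.Unary using (Pred; Decidable)
  open Counting

  private
    cons : ∀ {k} → Vec A k → A → Vec A (suc k)
    cons v x = x ∷ v

  vectors : (k : ℕ) → List (Vec A k)
  vectors zero    = [] ∷ []
  vectors (suc k) = cartesianProductWith cons (vectors k) xs

  length-vectors : ∀ k → length (vectors k) ≡ length xs ^ k
  length-vectors zero    = refl
  length-vectors (suc k) = begin
    length (vectors (suc k))         ≡⟨ length-cartesianProductWith cons (vectors k) xs ⟩
    length (vectors k) * length xs   ≡⟨ cong (_* length xs) (length-vectors k) ⟩
    length xs ^ k * length xs        ≡⟨ *-comm (length xs ^ k) (length xs) ⟩
    length xs ^ suc k                ∎
    where open ≡-Reasoning

  ∈-vectors : (∀ x → x ∈ xs) → ∀ {k} (v : Vec A k) → v ∈ vectors k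
  ∈-vectors ∈xs []      = here refl
  ∈-vectors ∈xs (x ∷ v) = ∈-cartesianProductWith⁺ cons (∈-vectors ∈xs v) (∈xs x)

  vectors-unique : Unique xs → ∀ k → Unique (vectors k)
  vectors-unique unique zero    = All.[] ∷ []
  vectors-unique unique (suc k) = Unique.cartesianProductWith⁺ cons
    (λ eq → ∷-injectiveʳ eq , ∷-injectiveˡ eq) (vectors-unique unique k) unique

  count-vectors-suc : ∀ {k} {P : Pred (Vec A (suc k)) 0ℓ} (P? : Decidable P) →
    count P? (vectors (suc k)) ≡ sum (map (λ v → count (λ x → P? (x ∷ v)) xs) (vectors k))
  count-vectors-suc {k} P? = count-cartesianProductWith P? cons (vectors k) xs

module FieldProperties (𝔽 : FiniteField) where

  open FiniteField 𝔽
  open import Algebra.Bundles using (CommutativeRing)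
  open import Data.Nat using (_^_)
  open import Data.List using (map; length; allFin)
  open import Data.List.Membership.Propositional using (_∈_)
  open import Data.List.Membership.Propositional.Properties using (∈-map⁺; ∈-allFin)
  open import Data.List.Properties using (length-map; length-tabulate)
  open import Data.List.Relation.Unary.Unique.Propositional using (Unique)
  import Data.List.Relation.Unary.Unique.Propositional.Properties as Unique
  open import Data.Product using (_,_)
  open import Function using (Inverse)
  open import Level using (0ℓ)
  open import Relation.Binary.PropositionalEquality

  commutativeRing : CommutativeRing 0ℓ 0ℓ
  commutativeRing = record { isCommutativeRing = isCommutativeRing }

  open CommutativeRing commutativeRing public
    using (_-_; +-identityˡ; +-identityʳ; *-identityˡ; *-identityʳ; -‿inverseʳ; zeroˡ; zeroʳ)
  open CommutativeRing commutativeRing using (ring; *-assoc; *-comm)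
  open import Algebra.Properties.Ring ring public using (-1*x≈-x; x∙y⁻¹≈ε⇒x≈y)
  open IntegerCoefficients commutativeRing public
  open ≡-Reasoning

  x≢0∧x*y≡0⇒y≡0 : ∀ {x y} → x ≢ 0# → x * y ≡ 0# → y ≡ 0#
  x≢0∧x*y≡0⇒y≡0 {x} {y} x≢0 xy≡0 with inverse x x≢0
  ... | x⁻¹ , xx⁻¹≡1 = begin
    y               ≡⟨ sym (*-identityˡ y) ⟩
    1# * y          ≡⟨ cong (_* y) (trans (sym xx⁻¹≡1) (*-comm x x⁻¹)) ⟩
    (x⁻¹ * x) * y   ≡⟨ *-assoc x⁻¹ x y ⟩
    x⁻¹ * (x * y)   ≡⟨ cong (x⁻¹ *_) xy≡0 ⟩
    x⁻¹ * 0#        ≡⟨ zeroʳ x⁻¹ ⟩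
    0#              ∎

  private module Enum = Inverse enum

  elements : List Carrier
  elements = map Enum.to (allFin size)

  ∈-elements : ∀ x → x ∈ elements
  ∈-elements x = subst (_∈ elements) (Enum.strictlyInverseˡ x) (∈-map⁺ Enum.to (∈-allFin (Enum.from x)))

  elements-unique : Unique elements
  elements-unique = Unique.map⁺ to-injective (Unique.allFin⁺ size)
    where
    to-injective : ∀ {i j} → Enum.to i ≡ Enum.to j → i ≡ j
    to-injective {i} {j} eq =
      trans (sym (Enum.strictlyInverseʳ i)) (trans (cong Enum.from eq) (Enum.strictlyInverseʳ j))

  length-elements : length elements ≡ size
  length-elements = trans (length-map Enum.to (allFin size)) (length-tabulate (λ i → i))

  open Vectors elements public

  length-vectors-size : ∀ k → length (vectors k) ≡ size ^ k
  length-vectors-size k = trans (length-vectors k) (cong (_^ k) length-elements)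

module Polynomials (𝔽 : FiniteField) where

  open FiniteField 𝔽
  open FieldProperties 𝔽
  open import Data.Fin using (Fin; zero; suc)
  open import Data.List using ([]; _∷_; map)
  open import Data.Nat as ℕ using (ℕ; zero; suc)
  import Data.Nat.Properties as ℕ
  open import Data.Product using (Σ-syntax; _×_; _,_)
  open import Data.Unit using (⊤; tt)
  open import Data.Vec using (Vec; _∷_; lookup)
  open import Relation.Binary.PropositionalEquality

  horner : List Carrier → Carrier → Carrier
  horner []       x = 0#
  horner (c ∷ cs) x = c + x * horner cs x

  horner-[_] : ∀ c x → horner (c ∷ []) x ≡ c
  horner-[ c ] x = trans (cong (c +_) (zeroʳ x)) (+-identityʳ c)

  Fun : ℕ → Set
  Fun k = Vec Carrier k → Carrier

  evalCoeffs : ∀ {k} → List (Fun k) → Vec Carrier k → Carrier → Carrier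
  evalCoeffs p r = horner (map (λ g → g r) p)

  -- A function of x ∷ r has total degree ≤ D if it is Σᵢ pᵢ(r) xⁱ with i ≤ D and deg pᵢ ≤ D ∸ i.
  mutual
    Degree≤ : (k : ℕ) → ℕ → Fun k → Set
    Degree≤ zero    D f = ⊤
    Degree≤ (suc k) D f =
      Σ[ p ∈ List (Fun k) ] Coeffs≤ k D p × (∀ x r → f (x ∷ r) ≡ evalCoeffs p r x)

    data Coeffs≤ (k : ℕ) : ℕ → List (Fun k) → Set where
      []  : ∀ {D} → Coeffs≤ k D []
      [_] : ∀ {g} → Degree≤ k 0 g → Coeffs≤ k 0 (g ∷ [])
      _∷_ : ∀ {D g p} → Degree≤ k (suc D) g → Coeffs≤ k D p → Coeffs≤ k (suc D) (g ∷ p)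

  degree-cong : ∀ {k D} {f g : Fun k} → (∀ r → f r ≡ g r) → Degree≤ k D f → Degree≤ k D g
  degree-cong {zero}  f≗g _              = tt
  degree-cong {suc k} f≗g (p , cs , f≈p) = p , cs , λ x r → trans (sym (f≗g (x ∷ r))) (f≈p x r)

  degree-const : ∀ {k D} c → Degree≤ k D (λ _ → c)
  degree-const {zero}          c = tt
  degree-const {suc k} {zero}  c = (λ _ → c) ∷ [] , [ degree-const c ] , λ x r → sym (horner-[ c ] x)
  degree-const {suc k} {suc D} c = (λ _ → c) ∷ [] , degree-const c ∷ [] , λ x r → sym (horner-[ c ] x)

  coeffs-[_] : ∀ {k D} {g : Fun k} → Degree≤ k D g → Coeffs≤ k D (g ∷ [])
  coeffs-[_] {D = zero}  dg = [ dg ]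
  coeffs-[_] {D = suc D} dg = dg ∷ []

  degree-lookup : ∀ {k} (i : Fin k) → Degree≤ k 1 (λ r → lookup r i)
  degree-lookup {suc k} zero    =
    (λ _ → 0#) ∷ (λ _ → 1#) ∷ [] , degree-const 0# ∷ [ degree-const 1# ] , λ x r → sym (begin
      0# + x * (1# + x * 0#)   ≡⟨ +-identityˡ _ ⟩
      x * (1# + x * 0#)        ≡⟨ cong (x *_) (horner-[ 1# ] x) ⟩
      x * 1#                   ≡⟨ *-identityʳ x ⟩
      x                        ∎)
    where open ≡-Reasoning
  degree-lookup {suc k} (suc i) =
    (λ r → lookup r i) ∷ [] , degree-lookup i ∷ [] , λ x r → sym (horner-[ lookup r i ] x)

  addCoeffs : ∀ {k} → List (Fun k) → List (Fun k) → List (Fun k)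
  addCoeffs []      q       = q
  addCoeffs (a ∷ p) []      = a ∷ p
  addCoeffs (a ∷ p) (b ∷ q) = (λ r → a r + b r) ∷ addCoeffs p q

  evalCoeffs-add : ∀ {k} (p q : List (Fun k)) r x →
    evalCoeffs (addCoeffs p q) r x ≡ evalCoeffs p r x + evalCoeffs q r x
  evalCoeffs-add []      q       r x = sym (+-identityˡ _)
  evalCoeffs-add (a ∷ p) []      r x = sym (+-identityʳ _)
  evalCoeffs-add (a ∷ p) (b ∷ q) r x rewrite evalCoeffs-add p q r x =
    solve 5 (λ a b x P Q → a :+ b :+ x :* (P :+ Q) := a :+ x :* P :+ (b :+ x :* Q)) refl
      (a r) (b r) x (evalCoeffs p r x) (evalCoeffs q r x)

  mutual
    degree-+ : ∀ {k D} {f g : Fun k} → Degree≤ k D f → Degree≤ k D g → Degree≤ k D (λ r → f r + g r)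
    degree-+ {zero}  _ _ = tt
    degree-+ {suc k} (p , ps , f≈p) (q , qs , g≈q) =
      addCoeffs p q , coeffs-+ ps qs ,
      λ x r → trans (cong₂ _+_ (f≈p x r) (g≈q x r)) (sym (evalCoeffs-add p q r x))

    coeffs-+ : ∀ {k D} {p q : List (Fun k)} → Coeffs≤ k D p → Coeffs≤ k D q → Coeffs≤ k D (addCoeffs p q)
    coeffs-+ []         qs         = qs
    coeffs-+ [ dp ]     []         = [ dp ]
    coeffs-+ [ dp ]     [ dq ]     = [ degree-+ dp dq ]
    coeffs-+ (dp ∷ ps)  []         = dp ∷ ps
    coeffs-+ (dp ∷ ps)  (dq ∷ qs)  = degree-+ dp dq ∷ coeffs-+ ps qs

  scaleCoeffs : ∀ {k} → Fun k → List (Fun k) → List (Fun k)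
  scaleCoeffs a = map (λ g r → a r * g r)

  shiftCoeffs : ∀ {k} → List (Fun k) → List (Fun k)
  shiftCoeffs p = (λ _ → 0#) ∷ p

  mulCoeffs : ∀ {k} → List (Fun k) → List (Fun k) → List (Fun k)
  mulCoeffs []      q = []
  mulCoeffs (a ∷ p) q = addCoeffs (scaleCoeffs a q) (shiftCoeffs (mulCoeffs p q))

  evalCoeffs-scale : ∀ {k} (a : Fun k) q r x → evalCoeffs (scaleCoeffs a q) r x ≡ a r * evalCoeffs q r x
  evalCoeffs-scale a []      r x = sym (zeroʳ _)
  evalCoeffs-scale a (b ∷ q) r x rewrite evalCoeffs-scale a q r x =
    solve 4 (λ a b x Q → a :* b :+ x :* (a :* Q) := a :* (b :+ x :* Q)) refl (a r) (b r) x (evalCoeffs q r x)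

  evalCoeffs-mul : ∀ {k} (p q : List (Fun k)) r x →
    evalCoeffs (mulCoeffs p q) r x ≡ evalCoeffs p r x * evalCoeffs q r x
  evalCoeffs-mul []      q r x = sym (zeroˡ _)
  evalCoeffs-mul (a ∷ p) q r x
    rewrite evalCoeffs-add (scaleCoeffs a q) (shiftCoeffs (mulCoeffs p q)) r x
          | evalCoeffs-scale a q r x | +-identityˡ (x * evalCoeffs (mulCoeffs p q) r x)
          | evalCoeffs-mul p q r x =
    solve 4 (λ a x P Q → a :* Q :+ x :* (P :* Q) := (a :+ x :* P) :* Q) refl
      (a r) x (evalCoeffs p r x) (evalCoeffs q r x)

  mutual
    degree-* : ∀ {k D₁ D₂} {f g : Fun k} → Degree≤ k D₁ f → Degree≤ k D₂ g →
               Degree≤ k (D₁ ℕ.+ D₂) (λ r → f r * g r)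
    degree-* {zero}  _ _ = tt
    degree-* {suc k} (p , ps , f≈p) (q , qs , g≈q) =
      mulCoeffs p q , coeffs-* ps qs ,
      λ x r → trans (cong₂ _*_ (f≈p x r) (g≈q x r)) (sym (evalCoeffs-mul p q r x))

    coeffs-scale : ∀ {k D₁ D₂} {a : Fun k} {q} → Degree≤ k D₁ a → Coeffs≤ k D₂ q →
                   Coeffs≤ k (D₁ ℕ.+ D₂) (scaleCoeffs a q)
    coeffs-scale da []        = []
    coeffs-scale da [ dq ]    = coeffs-[ degree-* da dq ]
    coeffs-scale {k} {D₁} {suc D₂} {a} {g ∷ q} da (dg ∷ qs) =
      subst (λ D → Coeffs≤ k D (scaleCoeffs a (g ∷ q))) (sym (ℕ.+-suc D₁ D₂))
        (subst (λ D → Degree≤ k D (λ r → a r * g r)) (ℕ.+-suc D₁ D₂) (degree-* da dg) ∷ coeffs-scale da qs)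

    coeffs-* : ∀ {k D₁ D₂} {p q : List (Fun k)} → Coeffs≤ k D₁ p → Coeffs≤ k D₂ q →
               Coeffs≤ k (D₁ ℕ.+ D₂) (mulCoeffs p q)
    coeffs-* []        qs = []
    coeffs-* [ da ]    qs = coeffs-+ (coeffs-scale da qs) coeffs-[ degree-const 0# ]
    coeffs-* (da ∷ ps) qs = coeffs-+ (coeffs-scale da qs) (degree-const 0# ∷ coeffs-* ps qs)

  degree-neg : ∀ {k D} {f : Fun k} → Degree≤ k D f → Degree≤ k D (λ r → - f r)
  degree-neg {D = D} df = degree-cong (λ r → -1*x≈-x _) (degree-* {D₁ = 0} {D₂ = D} (degree-const (- 1#)) df)

module SchwartzZippel (𝔽 : FiniteField) where

  open FiniteField 𝔽
  open FieldProperties 𝔽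
  open Polynomials 𝔽
  open Counting
  open import Data.List using ([]; _∷_; _∷ʳ_; map; length)
  open import Data.List.Relation.Unary.All as All using (All)
  open import Data.List.Relation.Unary.All.Properties using (¬All⇒Any¬)
  open import Data.List.Relation.Unary.Any as Any using (Any)
  open import Data.List.Relation.Unary.Unique.Propositional using (Unique)
  open import Data.List.Relation.Unary.AllPairs using (_∷_)
  open import Data.Nat as ℕ using (ℕ; zero; suc; _≤_; _<_; _∸_; z≤n; s≤s)
  import Data.Nat.Properties as ℕ
  open import Data.Nat.ListAction using (sum)
  open import Data.Nat.Tactic.RingSolver using (solve-∀)
  open import Data.Product using (∃; _,_; proj₁; proj₂)
  open import Data.Sum using (_⊎_; inj₁; inj₂)
  open import Data.Vec using ([]; _∷_; head; tail)
  open import Relation.Binary.PropositionalEquality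
  open import Relation.Nullary using (yes; no; contradiction)
  open import Relation.Unary using (Decidable)
  open import Relation.Unary.Properties using (∁?)

  data Leading≢0 : List Carrier → Set where
    [_] : ∀ {l} → l ≢ 0# → Leading≢0 (l ∷ [])
    _∷_ : ∀ c {cs} → Leading≢0 cs → Leading≢0 (c ∷ cs)

  -- Synthetic division by x - a.
  quotient : Carrier → List Carrier → List Carrier
  quotient a []            = []
  quotient a (c ∷ [])      = []
  quotient a (c ∷ c′ ∷ cs) = horner (c′ ∷ cs) a ∷ quotient a (c′ ∷ cs)

  horner-quotient : ∀ a cs x → horner cs x ≡ (x - a) * horner (quotient a cs) x + horner cs a
  horner-quotient a []            x = sym (trans (cong (_+ 0#) (zeroʳ (x - a))) (+-identityʳ 0#))
  horner-quotient a (c ∷ [])      x = begin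
    horner (c ∷ []) x           ≡⟨ horner-[ c ] x ⟩
    c                           ≡⟨ sym (horner-[ c ] a) ⟩
    horner (c ∷ []) a           ≡⟨ sym (+-identityˡ _) ⟩
    0# + horner (c ∷ []) a      ≡⟨ cong (_+ horner (c ∷ []) a) (sym (zeroʳ (x - a))) ⟩
    (x - a) * 0# + horner (c ∷ []) a ∎
    where open ≡-Reasoning
  horner-quotient a (c ∷ c′ ∷ cs) x rewrite horner-quotient a (c′ ∷ cs) x =
    solve 5 (λ x a c A Q → c :+ x :* ((x :- a) :* Q :+ A) := (x :- a) :* (A :+ x :* Q) :+ (c :+ a :* A))
      refl x a c (horner (c′ ∷ cs) a) (horner (quotient a (c′ ∷ cs)) x)

  quotient-leading : ∀ a {c c′ cs} → Leading≢0 (c ∷ c′ ∷ cs) → Leading≢0 (quotient a (c ∷ c′ ∷ cs))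
  quotient-leading a {cs = []}      (_ ∷ [ c′≢0 ]) = [ (λ eq → c′≢0 (trans (sym (horner-[ _ ] a)) eq)) ]
  quotient-leading a {cs = c″ ∷ cs} (_ ∷ lc)       = _ ∷ quotient-leading a lc

  length-quotient : ∀ a c cs → length (quotient a (c ∷ cs)) ≡ length cs
  length-quotient a c []        = refl
  length-quotient a c (c′ ∷ cs) = cong suc (length-quotient a c′ cs)

  quotient-root : ∀ {a} cs → horner cs a ≡ 0# → ∀ {y} → a ≢ y → horner cs y ≡ 0# →
                  horner (quotient a cs) y ≡ 0#
  quotient-root {a} cs a-root {y} a≢y y-root =
    x≢0∧x*y≡0⇒y≡0 (λ y-a≡0 → a≢y (sym (x∙y⁻¹≈ε⇒x≈y y a y-a≡0))) (begin
      (y - a) * horner (quotient a cs) y                ≡⟨ sym (+-identityʳ _) ⟩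
      (y - a) * horner (quotient a cs) y + 0#           ≡⟨ cong ((y - a) * horner (quotient a cs) y +_) (sym a-root) ⟩
      (y - a) * horner (quotient a cs) y + horner cs a  ≡⟨ sym (horner-quotient a cs y) ⟩
      horner cs y                                       ≡⟨ y-root ⟩
      0#                                                ∎)
    where open ≡-Reasoning

  root? : ∀ cs → Decidable (λ x → horner cs x ≡ 0#)
  root? cs x = horner cs x ≟ 0#

  roots<length : ∀ {cs} → Leading≢0 cs → ∀ {xs} → Unique xs → count (root? cs) xs < length cs
  roots<length [ _ ]   {[]} _ = s≤s z≤n
  roots<length (_ ∷ _) {[]} _ = s≤s z≤n
  roots<length {cs} lc {x ∷ xs} (x∉xs ∷ unique) with root? cs x
  ... | no _ = roots<length lc unique
  roots<length [ l≢0 ]          {x ∷ xs} (x∉xs ∷ unique) | yes root =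
    contradiction (trans (sym (horner-[ _ ] x)) root) l≢0
  roots<length {c ∷ c′ ∷ cs} lc {x ∷ xs} (x∉xs ∷ unique) | yes root = s≤s (begin-strict
    count (root? (c ∷ c′ ∷ cs)) xs
      ≤⟨ count-mono _ _ xs (All.map (quotient-root (c ∷ c′ ∷ cs) root) x∉xs) ⟩
    count (root? (quotient x (c ∷ c′ ∷ cs))) xs
      <⟨ roots<length (quotient-leading x lc) unique ⟩
    length (quotient x (c ∷ c′ ∷ cs))
      ≡⟨ length-quotient x c (c′ ∷ cs) ⟩
    length (c′ ∷ cs) ∎)
    where open ℕ.≤-Reasoning

  vanishes? : ∀ {k} (f : Fun k) → (∀ r → f r ≡ 0#) ⊎ ∃ λ r → f r ≢ 0#
  vanishes? {k} f with All.all? (λ r → f r ≟ 0#) (vectors k)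
  ... | yes f≡0 = inj₁ λ r → All.lookup f≡0 (∈-vectors ∈-elements r)
  ... | no  f≢0 = inj₂ (Any.satisfied (¬All⇒Any¬ (λ r → f r ≟ 0#) (vectors k) f≢0))

  record LeadingForm {k} (D : ℕ) (p : List (Fun k)) : Set where
    field
      lower   : List (Fun k)
      lead    : Fun k
      same    : ∀ r x → evalCoeffs p r x ≡ evalCoeffs (lower ∷ʳ lead) r x
      bounded : length lower ≤ D
      degree  : Degree≤ k (D ∸ length lower) lead
      nonzero : ∃ λ r → lead r ≢ 0#

  leadingForm : ∀ {k D p} → Coeffs≤ k D p → (∀ x r → evalCoeffs p r x ≡ 0#) ⊎ LeadingForm D p
  leadingForm [] = inj₁ λ _ _ → refl
  leadingForm {p = g ∷ []} [ dg ] with vanishes? g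
  ... | inj₁ g≡0 = inj₁ λ x r → trans (horner-[ g r ] x) (g≡0 r)
  ... | inj₂ g≢0 = inj₂ record
    { lower = [] ; lead = g ; same = λ _ _ → refl ; bounded = z≤n ; degree = dg ; nonzero = g≢0 }
  leadingForm {p = g ∷ p} (dg ∷ ps) with leadingForm ps
  ... | inj₂ lf = inj₂ record
    { lower   = g ∷ lower
    ; lead    = lead
    ; same    = λ r x → cong (λ t → g r + x * t) (same r x)
    ; bounded = s≤s bounded
    ; degree  = degree
    ; nonzero = nonzero
    }
    where open LeadingForm lf
  ... | inj₁ p≡0 with vanishes? g
  ...   | inj₁ g≡0 = inj₁ λ x r → begin
    g r + x * evalCoeffs p r x   ≡⟨ cong₂ (λ a b → a + x * b) (g≡0 r) (p≡0 x r) ⟩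
    0# + x * 0#                 ≡⟨ horner-[ 0# ] x ⟩
    0#                          ∎
    where open ≡-Reasoning
  ...   | inj₂ g≢0 = inj₂ record
    { lower   = []
    ; lead    = g
    ; same    = λ r x → cong (λ t → g r + x * t) (p≡0 x r)
    ; bounded = z≤n
    ; degree  = dg
    ; nonzero = g≢0
    }

  leading≢0-∷ʳ : ∀ {k} (lower : List (Fun k)) {g} r → g r ≢ 0# → Leading≢0 (map (λ h → h r) (lower ∷ʳ g))
  leading≢0-∷ʳ []          r g≢0 = [ g≢0 ]
  leading≢0-∷ʳ (h ∷ lower) r g≢0 = h r ∷ leading≢0-∷ʳ lower r g≢0

  length-map-∷ʳ : ∀ {k} (lower : List (Fun k)) g r → length (map (λ h → h r) (lower ∷ʳ g)) ≡ suc (length lower)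
  length-map-∷ʳ []          g r = refl
  length-map-∷ʳ (h ∷ lower) g r = cong suc (length-map-∷ʳ lower g r)

  zeros : ∀ {k} → Fun k → ℕ
  zeros {k} f = count (λ r → f r ≟ 0#) (vectors k)

  fromCoeffs : ∀ {k} → List (Fun k) → Fun (suc k)
  fromCoeffs p v = evalCoeffs p (tail v) (head v)

  private
    q = size

  -- For each r, the polynomial x ↦ evalCoeffs p r x has at most length lower roots if lead r ≢ 0,
  -- and at most q otherwise.
  zeros-leadingForm : ∀ {k D p} (lf : LeadingForm {k} D p) →
    let open LeadingForm lf in
    zeros (fromCoeffs p) ≤ q ℕ.* zeros lead ℕ.+ length lower ℕ.* q ℕ.^ k
  zeros-leadingForm {k} {D} {p} lf = begin
    zeros (fromCoeffs p)
      ≡⟨ count-vectors-suc (λ v → fromCoeffs p v ≟ 0#) ⟩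
    sum (map (λ r → count (λ x → evalCoeffs p r x ≟ 0#) elements) (vectors k))
      ≤⟨ sum-map-≤-count (λ r → lead r ≟ 0#) at-most-q at-most-T (vectors k) ⟩
    q ℕ.* zeros lead ℕ.+ T ℕ.* count (∁? (λ r → lead r ≟ 0#)) (vectors k)
      ≤⟨ ℕ.+-monoʳ-≤ (q ℕ.* zeros lead) (ℕ.*-monoʳ-≤ T (count≤length (∁? (λ r → lead r ≟ 0#)) (vectors k))) ⟩
    q ℕ.* zeros lead ℕ.+ T ℕ.* length (vectors k)
      ≡⟨ cong (λ l → q ℕ.* zeros lead ℕ.+ T ℕ.* l) (length-vectors-size k) ⟩
    q ℕ.* zeros lead ℕ.+ T ℕ.* q ℕ.^ k ∎
    where
    open LeadingForm lf
    open ℕ.≤-Reasoning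
    T = length lower
    at-most-q : ∀ r → lead r ≡ 0# → count (λ x → evalCoeffs p r x ≟ 0#) elements ≤ q
    at-most-q r _ = ℕ.≤-trans (count≤length _ elements) (ℕ.≤-reflexive length-elements)
    at-most-T : ∀ r → lead r ≢ 0# → count (λ x → evalCoeffs p r x ≟ 0#) elements ≤ T
    at-most-T r lead≢0 = ℕ.≤-pred (begin-strict
      count (λ x → evalCoeffs p r x ≟ 0#) elements
        ≤⟨ count-mono _ _ elements (All.tabulate (λ {x} _ → trans (sym (same r x))) ) ⟩
      count (root? (map (λ h → h r) (lower ∷ʳ lead))) elements
        <⟨ roots<length (leading≢0-∷ʳ lower r lead≢0) elements-unique ⟩
      length (map (λ h → h r) (lower ∷ʳ lead))
        ≡⟨ length-map-∷ʳ lower lead r ⟩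
      suc T ∎)

  schwartz-zippel : ∀ {k D} {f : Fun k} → Degree≤ k D f → ∀ r₀ → f r₀ ≢ 0# → zeros f ℕ.* q ≤ D ℕ.* q ℕ.^ k
  schwartz-zippel {zero} {f = f} _ [] f≢0 with f [] ≟ 0#
  ... | yes f≡0 = contradiction f≡0 f≢0
  ... | no _    = z≤n
  schwartz-zippel {suc k} {D} {f} (p , ps , f≈p) (x₀ ∷ r₀) f≢0 with leadingForm ps
  ... | inj₁ p≡0 = contradiction (trans (f≈p x₀ r₀) (p≡0 x₀ r₀)) f≢0
  ... | inj₂ lf  = begin
    zeros f ℕ.* q
      ≤⟨ ℕ.*-monoˡ-≤ q (count-mono _ _ (vectors (suc k)) (All.tabulate λ { {x ∷ r} _ → trans (sym (f≈p x r)) })) ⟩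
    zeros (fromCoeffs p) ℕ.* q
      ≤⟨ ℕ.*-monoˡ-≤ q (zeros-leadingForm lf) ⟩
    (q ℕ.* zeros lead ℕ.+ T ℕ.* q ℕ.^ k) ℕ.* q
      ≡⟨ distribute q (zeros lead) T (q ℕ.^ k) ⟩
    q ℕ.* (zeros lead ℕ.* q) ℕ.+ T ℕ.* (q ℕ.* q ℕ.^ k)
      ≤⟨ ℕ.+-monoˡ-≤ _ (ℕ.*-monoʳ-≤ q (schwartz-zippel degree r₁ lead≢0)) ⟩
    q ℕ.* ((D ∸ T) ℕ.* q ℕ.^ k) ℕ.+ T ℕ.* (q ℕ.* q ℕ.^ k)
      ≡⟨ collect q (D ∸ T) T (q ℕ.^ k) ⟩
    (D ∸ T ℕ.+ T) ℕ.* (q ℕ.* q ℕ.^ k)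
      ≡⟨ cong (ℕ._* (q ℕ.* q ℕ.^ k)) (ℕ.m∸n+n≡m bounded) ⟩
    D ℕ.* q ℕ.^ suc k ∎
    where
    open LeadingForm lf
    open ℕ.≤-Reasoning
    T  = length lower
    r₁ = proj₁ nonzero
    lead≢0 = proj₂ nonzero
    distribute : ∀ q z t Q → (q ℕ.* z ℕ.+ t ℕ.* Q) ℕ.* q ≡ q ℕ.* (z ℕ.* q) ℕ.+ t ℕ.* (q ℕ.* Q)
    distribute = solve-∀
    collect : ∀ q a t Q → q ℕ.* (a ℕ.* Q) ℕ.+ t ℕ.* (q ℕ.* Q) ≡ (a ℕ.+ t) ℕ.* (q ℕ.* Q)
    collect = solve-∀

module Determinants {c ℓ} (R : Algebra.Bundles.CommutativeRing c ℓ) where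

  open Algebra.Bundles.CommutativeRing R hiding (zero)
  open import Algebra.Properties.Ring ring using (-0#≈0#)
  open import Function using (_∘_)
  open import Level using (_⊔_)
  open IntegerCoefficients R using (solve; _:=_; _:+_; _:*_; :-_; _:-_)
  open import Data.Fin as Fin using (Fin; zero; suc)
  open import Data.Fin.Properties using (suc-injective)
  open import Data.List using ([]; _∷_; [_]; _++_; _∷ʳ_; map; tabulate; foldr)
  open import Data.List.Properties using (++-assoc; map-++; map-tabulate; tabulate-cong)
  open import Data.List.Membership.Propositional using (_∈_)
  open import Data.List.Membership.Propositional.Properties using (∈-∃++; ∈-map⁺)
  open import Data.List.Relation.Unary.All using (All; []; _∷_)
  import Data.List.Relation.Unary.All.Properties as All
  open import Data.List.Relation.Unary.Any using (here; there)
  open import Data.Nat using (ℕ; zero; suc)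
  open import Data.Product using (_×_; _,_; proj₂)
  open import Data.Vec as Vec using (Vec; _∷_; head; tail; lookup; replicate; zipWith)
  import Data.Vec.Properties as Vec
  open import Relation.Binary.PropositionalEquality as ≡ using (_≡_; _≢_)
  open import Relation.Nullary using (yes; no; contradiction)
  open import Relation.Binary.Reasoning.Setoid setoid

  Column : ℕ → Set c
  Column k = Vec Carrier k

  tails : ∀ {k} → List (Column (suc k)) → List (Column k)
  tails = map tail

  -- Laplace expansion along the first row: expand k pre post sums, with alternating signs,
  -- the terms of the columns in post, each minor deleting that column from pre ++ post.
  -- A nonempty list of empty columns gets determinant 0, so that det is alternating on all lists.
  mutual
    det : (k : ℕ) → List (Column k) → Carrier
    det zero    []      = 1#
    det zero    (_ ∷ _) = 0#
    det (suc k) cs      = expand k [] cs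

    expand : (k : ℕ) → List (Column (suc k)) → List (Column (suc k)) → Carrier
    expand k pre []         = 0#
    expand k pre (c ∷ post) = head c * det k (tails (pre ++ post)) - expand k (pre ∷ʳ c) post

  private
    neg-step : ∀ h D X → h * - D - - X ≈ - (h * D - X)
    neg-step = solve 3 (λ h D X → h :* (:- D) :- (:- X) := :- (h :* D :- X)) refl

    swap-steps : ∀ a b D₁ D₂ X → a * D₁ - (b * D₂ - - X) ≈ - (b * D₂ - (a * D₁ - X))
    swap-steps = solve 5 (λ a b D₁ D₂ X → a :* D₁ :- (b :* D₂ :- (:- X)) := :- (b :* D₂ :- (a :* D₁ :- X))) refl

    cancel-step : ∀ h D X → h * D - (h * D - X) ≈ X
    cancel-step = solve 3 (λ h D X → h :* D :- (h :* D :- X) := X) refl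

    linear-step-minor : ∀ h α β D₁ D₂ X₁ X₂ →
      h * (α * D₁ + β * D₂) - (α * X₁ + β * X₂) ≈ α * (h * D₁ - X₁) + β * (h * D₂ - X₂)
    linear-step-minor = solve 7 (λ h α β D₁ D₂ X₁ X₂ →
      h :* (α :* D₁ :+ β :* D₂) :- (α :* X₁ :+ β :* X₂) := α :* (h :* D₁ :- X₁) :+ β :* (h :* D₂ :- X₂)) refl

    linear-step-head : ∀ h₁ h₂ α β D X₁ X₂ →
      (α * h₁ + β * h₂) * D - (α * X₁ + β * X₂) ≈ α * (h₁ * D - X₁) + β * (h₂ * D - X₂)
    linear-step-head = solve 7 (λ h₁ h₂ α β D X₁ X₂ →
      (α :* h₁ :+ β :* h₂) :* D :- (α :* X₁ :+ β :* X₂) := α :* (h₁ :* D :- X₁) :+ β :* (h₂ :* D :- X₂)) refl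

    zero-step : ∀ h → h * 0# - 0# ≈ 0#
    zero-step h = trans (+-cong (zeroʳ h) -0#≈0#) (+-identityʳ 0#)

    zero-combination : ∀ α β → α * 0# + β * 0# ≈ 0#
    zero-combination α β = trans (+-cong (zeroʳ α) (zeroʳ β)) (+-identityʳ 0#)

  det-zero-nonempty : ∀ xs (a : Column 0) ys → det 0 (xs ++ a ∷ ys) ≡ 0#
  det-zero-nonempty []      a ys = ≡.refl
  det-zero-nonempty (_ ∷ _) a ys = ≡.refl

  expand-∷-pre : ∀ k pre mid c L → expand k (pre ++ mid) (c ∷ L) ≡
    head c * det k (tails pre ++ tails (mid ++ L)) - expand k (pre ++ (mid ∷ʳ c)) L
  expand-∷-pre k pre mid c L = ≡.cong₂ (λ u w → head c * det k u - expand k w L)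
    (≡.trans (≡.cong tails (++-assoc pre mid L)) (map-++ tail pre (mid ++ L))) (++-assoc pre mid [ c ])

  expand-∷-post : ∀ k pre c xs rest → expand k pre (c ∷ xs ++ rest) ≡
    head c * det k (tails (pre ++ xs) ++ tails rest) - expand k (pre ∷ʳ c) (xs ++ rest)
  expand-∷-post k pre c xs rest = ≡.cong (λ u → head c * det k u - expand k (pre ∷ʳ c) (xs ++ rest))
    (≡.trans (≡.cong tails (≡.sym (++-assoc pre xs rest))) (map-++ tail (pre ++ xs) rest))

  mutual
    det-swap : ∀ k xs a b ys → det k (xs ++ a ∷ b ∷ ys) ≈ - det k (xs ++ b ∷ a ∷ ys)
    det-swap zero    xs a b ys = begin
      det 0 (xs ++ a ∷ b ∷ ys)   ≡⟨ det-zero-nonempty xs a (b ∷ ys) ⟩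
      0#                         ≈⟨ sym -0#≈0# ⟩
      - 0#                       ≡⟨ ≡.cong -_ (≡.sym (det-zero-nonempty xs b (a ∷ ys))) ⟩
      - det 0 (xs ++ b ∷ a ∷ ys) ∎
    det-swap (suc k) xs a b ys = expand-swap-post k [] xs a b ys

    expand-swap-pre : ∀ k P a b Q L → expand k (P ++ a ∷ b ∷ Q) L ≈ - expand k (P ++ b ∷ a ∷ Q) L
    expand-swap-pre k P a b Q []      = sym -0#≈0#
    expand-swap-pre k P a b Q (c ∷ L) = begin
      expand k (P ++ a ∷ b ∷ Q) (c ∷ L)
        ≡⟨ expand-∷-pre k P (a ∷ b ∷ Q) c L ⟩
      head c * det k (tails P ++ tail a ∷ tail b ∷ tails (Q ++ L)) - expand k (P ++ a ∷ b ∷ (Q ∷ʳ c)) L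
        ≈⟨ +-cong (*-congˡ (det-swap k (tails P) (tail a) (tail b) (tails (Q ++ L))))
                  (-‿cong (expand-swap-pre k P a b (Q ∷ʳ c) L)) ⟩
      head c * - det k (tails P ++ tail b ∷ tail a ∷ tails (Q ++ L)) - - expand k (P ++ b ∷ a ∷ (Q ∷ʳ c)) L
        ≈⟨ neg-step _ _ _ ⟩
      - (head c * det k (tails P ++ tail b ∷ tail a ∷ tails (Q ++ L)) - expand k (P ++ b ∷ a ∷ (Q ∷ʳ c)) L)
        ≡⟨ ≡.cong -_ (≡.sym (expand-∷-pre k P (b ∷ a ∷ Q) c L)) ⟩
      - expand k (P ++ b ∷ a ∷ Q) (c ∷ L) ∎

    expand-swap-head : ∀ k pre a b L → expand k pre (a ∷ b ∷ L) ≈ - expand k pre (b ∷ a ∷ L)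
    expand-swap-head k pre a b L = begin
      expand k pre (a ∷ b ∷ L)
        ≡⟨ ≡.cong₂ (λ u w → head a * Dᵇ - (head b * det k (tails u) - expand k w L))
                   (++-assoc pre [ a ] L) (++-assoc pre [ a ] [ b ]) ⟩
      head a * Dᵇ - (head b * Dᵃ - expand k (pre ++ a ∷ b ∷ []) L)
        ≈⟨ +-congˡ (-‿cong (+-congˡ (-‿cong (expand-swap-pre k pre a b [] L)))) ⟩
      head a * Dᵇ - (head b * Dᵃ - - expand k (pre ++ b ∷ a ∷ []) L)
        ≈⟨ swap-steps _ _ _ _ _ ⟩
      - (head b * Dᵃ - (head a * Dᵇ - expand k (pre ++ b ∷ a ∷ []) L))
        ≡⟨ ≡.cong₂ (λ u w → - (head b * Dᵃ - (head a * det k (tails u) - expand k w L)))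
                   (≡.sym (++-assoc pre [ b ] L)) (≡.sym (++-assoc pre [ b ] [ a ])) ⟩
      - expand k pre (b ∷ a ∷ L) ∎
      where
      Dᵃ = det k (tails (pre ++ a ∷ L))
      Dᵇ = det k (tails (pre ++ b ∷ L))

    expand-swap-post : ∀ k pre xs a b ys → expand k pre (xs ++ a ∷ b ∷ ys) ≈ - expand k pre (xs ++ b ∷ a ∷ ys)
    expand-swap-post k pre []       a b ys = expand-swap-head k pre a b ys
    expand-swap-post k pre (c ∷ xs) a b ys = begin
      expand k pre (c ∷ xs ++ a ∷ b ∷ ys)
        ≡⟨ expand-∷-post k pre c xs (a ∷ b ∷ ys) ⟩
      head c * det k (tails (pre ++ xs) ++ tail a ∷ tail b ∷ tails ys) - expand k (pre ∷ʳ c) (xs ++ a ∷ b ∷ ys)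
        ≈⟨ +-cong (*-congˡ (det-swap k (tails (pre ++ xs)) (tail a) (tail b) (tails ys)))
                  (-‿cong (expand-swap-post k (pre ∷ʳ c) xs a b ys)) ⟩
      head c * - det k (tails (pre ++ xs) ++ tail b ∷ tail a ∷ tails ys) - - expand k (pre ∷ʳ c) (xs ++ b ∷ a ∷ ys)
        ≈⟨ neg-step _ _ _ ⟩
      - (head c * det k (tails (pre ++ xs) ++ tail b ∷ tail a ∷ tails ys) - expand k (pre ∷ʳ c) (xs ++ b ∷ a ∷ ys))
        ≡⟨ ≡.cong -_ (≡.sym (expand-∷-post k pre c xs (b ∷ a ∷ ys))) ⟩
      - expand k pre (c ∷ xs ++ b ∷ a ∷ ys) ∎

  mutual
    det-adjacent : ∀ k xs a ys → det k (xs ++ a ∷ a ∷ ys) ≈ 0#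
    det-adjacent zero    xs a ys = reflexive (det-zero-nonempty xs a (a ∷ ys))
    det-adjacent (suc k) xs a ys = expand-adjacent-post k [] xs a ys

    expand-adjacent-pre : ∀ k P a Q L → expand k (P ++ a ∷ a ∷ Q) L ≈ 0#
    expand-adjacent-pre k P a Q []      = refl
    expand-adjacent-pre k P a Q (c ∷ L) = begin
      expand k (P ++ a ∷ a ∷ Q) (c ∷ L)
        ≡⟨ expand-∷-pre k P (a ∷ a ∷ Q) c L ⟩
      head c * det k (tails P ++ tail a ∷ tail a ∷ tails (Q ++ L)) - expand k (P ++ a ∷ a ∷ (Q ∷ʳ c)) L
        ≈⟨ +-cong (*-congˡ (det-adjacent k (tails P) (tail a) (tails (Q ++ L))))
                  (-‿cong (expand-adjacent-pre k P a (Q ∷ʳ c) L)) ⟩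
      head c * 0# - 0#
        ≈⟨ zero-step (head c) ⟩
      0# ∎

    expand-adjacent-post : ∀ k pre xs a ys → expand k pre (xs ++ a ∷ a ∷ ys) ≈ 0#
    expand-adjacent-post k pre []       a ys = begin
      expand k pre (a ∷ a ∷ ys)
        ≡⟨ ≡.cong₂ (λ u w → head a * D - (head a * det k (tails u) - expand k w ys))
                   (++-assoc pre [ a ] ys) (++-assoc pre [ a ] [ a ]) ⟩
      head a * D - (head a * D - expand k (pre ++ a ∷ a ∷ []) ys)
        ≈⟨ cancel-step _ _ _ ⟩
      expand k (pre ++ a ∷ a ∷ []) ys
        ≈⟨ expand-adjacent-pre k pre a [] ys ⟩
      0# ∎
      where D = det k (tails (pre ++ a ∷ ys))
    expand-adjacent-post k pre (c ∷ xs) a ys = begin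
      expand k pre (c ∷ xs ++ a ∷ a ∷ ys)
        ≡⟨ expand-∷-post k pre c xs (a ∷ a ∷ ys) ⟩
      head c * det k (tails (pre ++ xs) ++ tail a ∷ tail a ∷ tails ys) - expand k (pre ∷ʳ c) (xs ++ a ∷ a ∷ ys)
        ≈⟨ +-cong (*-congˡ (det-adjacent k (tails (pre ++ xs)) (tail a) (tails ys)))
                  (-‿cong (expand-adjacent-post k (pre ∷ʳ c) xs a ys)) ⟩
      head c * 0# - 0#
        ≈⟨ zero-step (head c) ⟩
      0# ∎

  det-duplicate : ∀ k xs a ys zs → det k (xs ++ a ∷ ys ++ a ∷ zs) ≈ 0#
  det-duplicate k xs a []       zs = det-adjacent k xs a zs
  det-duplicate k xs a (b ∷ ys) zs = begin
    det k (xs ++ a ∷ b ∷ ys ++ a ∷ zs)        ≈⟨ det-swap k xs a b (ys ++ a ∷ zs) ⟩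
    - det k (xs ++ b ∷ a ∷ ys ++ a ∷ zs)      ≡⟨ ≡.cong (λ u → - det k u) (≡.sym (++-assoc xs [ b ] (a ∷ ys ++ a ∷ zs))) ⟩
    - det k ((xs ∷ʳ b) ++ a ∷ ys ++ a ∷ zs)   ≈⟨ -‿cong (det-duplicate k (xs ∷ʳ b) a ys zs) ⟩
    - 0#                                      ≈⟨ -0#≈0# ⟩
    0#                                        ∎

  det-∈ : ∀ k {a ys} → a ∈ ys → det k (a ∷ ys) ≈ 0#
  det-∈ k {a} a∈ys with ∈-∃++ a∈ys
  ... | ys₁ , ys₂ , ≡.refl = det-duplicate k [] a ys₁ ys₂

  record LinComb {k} (α : Carrier) (u : Column k) (β : Carrier) (v w : Column k) : Set ℓ where
    constructor lincomb
    field lookup-≈ : ∀ i → lookup w i ≈ α * lookup u i + β * lookup v i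

  private
    lincomb-head : ∀ {k α β} {u v w : Column (suc k)} → LinComb α u β v w → head w ≈ α * head u + β * head v
    lincomb-head {u = _ ∷ _} {_ ∷ _} {_ ∷ _} (lincomb w≈) = w≈ zero

    lincomb-tail : ∀ {k α β} {u v w : Column (suc k)} → LinComb α u β v w → LinComb α (tail u) β (tail v) (tail w)
    lincomb-tail {u = _ ∷ _} {_ ∷ _} {_ ∷ _} (lincomb w≈) = lincomb (w≈ ∘ suc)

  mutual
    det-linear : ∀ k xs ys {α β} {u v w : Column k} → LinComb α u β v w →
      det k (xs ++ w ∷ ys) ≈ α * det k (xs ++ u ∷ ys) + β * det k (xs ++ v ∷ ys)
    det-linear zero xs ys {α} {β} {u} {v} {w} _ = begin
      det 0 (xs ++ w ∷ ys)    ≡⟨ det-zero-nonempty xs w ys ⟩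
      0#                      ≈⟨ sym (zero-combination α β) ⟩
      α * 0# + β * 0#         ≡⟨ ≡.sym (≡.cong₂ (λ a b → α * a + β * b) (det-zero-nonempty xs u ys) (det-zero-nonempty xs v ys)) ⟩
      α * det 0 (xs ++ u ∷ ys) + β * det 0 (xs ++ v ∷ ys) ∎
    det-linear (suc k) xs ys w≈ = expand-linear-post k [] xs ys w≈

    expand-linear-pre : ∀ k P Q L {α β u v w} → LinComb α u β v w →
      expand k (P ++ w ∷ Q) L ≈ α * expand k (P ++ u ∷ Q) L + β * expand k (P ++ v ∷ Q) L
    expand-linear-pre k P Q []      {α} {β} w≈ = sym (zero-combination α β)
    expand-linear-pre k P Q (c ∷ L) {α} {β} {u} {v} {w} w≈ = begin
      expand k (P ++ w ∷ Q) (c ∷ L)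
        ≡⟨ expand-∷-pre k P (w ∷ Q) c L ⟩
      head c * det k (tails P ++ tail w ∷ tails (Q ++ L)) - expand k (P ++ w ∷ (Q ∷ʳ c)) L
        ≈⟨ +-cong (*-congˡ (det-linear k (tails P) (tails (Q ++ L)) (lincomb-tail w≈)))
                  (-‿cong (expand-linear-pre k P (Q ∷ʳ c) L w≈)) ⟩
      head c * (α * Dᵘ + β * Dᵛ) - (α * expand k (P ++ u ∷ (Q ∷ʳ c)) L + β * expand k (P ++ v ∷ (Q ∷ʳ c)) L)
        ≈⟨ linear-step-minor _ _ _ _ _ _ _ ⟩
      α * (head c * Dᵘ - expand k (P ++ u ∷ (Q ∷ʳ c)) L) + β * (head c * Dᵛ - expand k (P ++ v ∷ (Q ∷ʳ c)) L)
        ≡⟨ ≡.sym (≡.cong₂ (λ a b → α * a + β * b) (expand-∷-pre k P (u ∷ Q) c L) (expand-∷-pre k P (v ∷ Q) c L)) ⟩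
      α * expand k (P ++ u ∷ Q) (c ∷ L) + β * expand k (P ++ v ∷ Q) (c ∷ L) ∎
      where
      Dᵘ = det k (tails P ++ tail u ∷ tails (Q ++ L))
      Dᵛ = det k (tails P ++ tail v ∷ tails (Q ++ L))

    expand-linear-post : ∀ k pre xs ys {α β u v w} → LinComb α u β v w →
      expand k pre (xs ++ w ∷ ys) ≈ α * expand k pre (xs ++ u ∷ ys) + β * expand k pre (xs ++ v ∷ ys)
    expand-linear-post k pre []       ys {α} {β} {u} {v} {w} w≈ = begin
      head w * D - expand k (pre ∷ʳ w) ys
        ≈⟨ +-cong (*-congʳ (lincomb-head w≈)) (-‿cong (expand-linear-pre k pre [] ys w≈)) ⟩
      (α * head u + β * head v) * D - (α * expand k (pre ∷ʳ u) ys + β * expand k (pre ∷ʳ v) ys)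
        ≈⟨ linear-step-head _ _ _ _ _ _ _ ⟩
      α * (head u * D - expand k (pre ∷ʳ u) ys) + β * (head v * D - expand k (pre ∷ʳ v) ys) ∎
      where D = det k (tails (pre ++ ys))
    expand-linear-post k pre (c ∷ xs) ys {α} {β} {u} {v} {w} w≈ = begin
      expand k pre (c ∷ xs ++ w ∷ ys)
        ≡⟨ expand-∷-post k pre c xs (w ∷ ys) ⟩
      head c * det k (tails (pre ++ xs) ++ tail w ∷ tails ys) - expand k (pre ∷ʳ c) (xs ++ w ∷ ys)
        ≈⟨ +-cong (*-congˡ (det-linear k (tails (pre ++ xs)) (tails ys) (lincomb-tail w≈)))
                  (-‿cong (expand-linear-post k (pre ∷ʳ c) xs ys w≈)) ⟩
      head c * (α * Dᵘ + β * Dᵛ) - (α * expand k (pre ∷ʳ c) (xs ++ u ∷ ys) + β * expand k (pre ∷ʳ c) (xs ++ v ∷ ys))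
        ≈⟨ linear-step-minor _ _ _ _ _ _ _ ⟩
      α * (head c * Dᵘ - expand k (pre ∷ʳ c) (xs ++ u ∷ ys)) + β * (head c * Dᵛ - expand k (pre ∷ʳ c) (xs ++ v ∷ ys))
        ≡⟨ ≡.sym (≡.cong₂ (λ a b → α * a + β * b) (expand-∷-post k pre c xs (u ∷ ys)) (expand-∷-post k pre c xs (v ∷ ys))) ⟩
      α * expand k pre (c ∷ xs ++ u ∷ ys) + β * expand k pre (c ∷ xs ++ v ∷ ys) ∎
      where
      Dᵘ = det k (tails (pre ++ xs) ++ tail u ∷ tails ys)
      Dᵛ = det k (tails (pre ++ xs) ++ tail v ∷ tails ys)

  Linear : ∀ {k} → (Column k → Carrier) → Set (c ⊔ ℓ)
  Linear L = ∀ {α β u v w} → LinComb α u β v w → L w ≈ α * L u + β * L v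

  lookup-linear : ∀ {k} (i : Fin k) → Linear (λ w → lookup w i)
  lookup-linear i (lincomb w≈) = w≈ i

  linear-zero : ∀ {k} {L : Column k → Carrier} → Linear L → ∀ {w} → (∀ i → lookup w i ≈ 0#) → L w ≈ 0#
  linear-zero {L = L} linear {w} w≈0 = begin
    L w                     ≈⟨ linear (lincomb w≈0·w+0·w) ⟩
    0# * L w + 0# * L w     ≈⟨ trans (+-cong (zeroˡ _) (zeroˡ _)) (+-identityʳ 0#) ⟩
    0#                      ∎
    where
    w≈0·w+0·w : ∀ i → lookup w i ≈ 0# * lookup w i + 0# * lookup w i
    w≈0·w+0·w i = trans (w≈0 i) (sym (trans (+-cong (zeroˡ _) (zeroˡ _)) (+-identityʳ 0#)))

  combination : ∀ {k} → List (Carrier × Column k) → Column k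
  combination []             = replicate _ 0#
  combination ((z , c) ∷ ps) = zipWith (λ x y → z * x + y) c (combination ps)

  sumᶜ : List Carrier → Carrier
  sumᶜ = foldr _+_ 0#

  sumᶜ-tabulate-zero : ∀ {k} (g : Fin k → Carrier) → (∀ b → g b ≈ 0#) → sumᶜ (tabulate g) ≈ 0#
  sumᶜ-tabulate-zero {zero}  g g≈0 = refl
  sumᶜ-tabulate-zero {suc k} g g≈0 = trans (+-cong (g≈0 zero) (sumᶜ-tabulate-zero (g ∘ suc) (g≈0 ∘ suc))) (+-identityˡ 0#)

  sumᶜ-tabulate-single : ∀ {k} (g : Fin k → Carrier) b₀ → (∀ b → b ≢ b₀ → g b ≈ 0#) → sumᶜ (tabulate g) ≈ g b₀
  sumᶜ-tabulate-single {suc k} g zero     others =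
    trans (+-congˡ (sumᶜ-tabulate-zero (g ∘ suc) (λ b → others (suc b) λ ()))) (+-identityʳ _)
  sumᶜ-tabulate-single {suc k} g (suc b₀) others =
    trans (+-cong (others zero λ ()) (sumᶜ-tabulate-single (g ∘ suc) b₀ (λ b b≢b₀ → others (suc b) (b≢b₀ ∘ suc-injective))))
          (+-identityˡ _)

  linear-combination : ∀ {k} {L : Column k → Carrier} → Linear L → ∀ ps →
    L (combination ps) ≈ sumᶜ (map (λ (z , c) → z * L c) ps)
  linear-combination linear []             =
    linear-zero linear (λ i → reflexive (Vec.lookup-replicate i 0#))
  linear-combination {L = L} linear ((z , c) ∷ ps) = begin
    L (combination ((z , c) ∷ ps))          ≈⟨ linear (lincomb unfold) ⟩
    z * L c + 1# * L (combination ps)       ≈⟨ +-congˡ (trans (*-identityˡ _) (linear-combination linear ps)) ⟩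
    z * L c + sumᶜ (map (λ (z , c) → z * L c) ps) ∎
    where
    unfold : ∀ i → lookup (combination ((z , c) ∷ ps)) i ≈ z * lookup c i + 1# * lookup (combination ps) i
    unfold i = trans (reflexive (Vec.lookup-zipWith _ i c (combination ps))) (+-congˡ (sym (*-identityˡ _)))

  -- Expanding det linearly in its first column, all terms but the first repeat a column.
  det-dependent : ∀ {k} z c (ps : List (Carrier × Column k)) →
    (∀ i → lookup (combination ((z , c) ∷ ps)) i ≈ 0#) → z * det k (c ∷ map proj₂ ps) ≈ 0#
  det-dependent {k} z c ps combination≈0 = begin
    z * det k (c ∷ ys)                                          ≈⟨ sym (+-identityʳ _) ⟩
    z * det k (c ∷ ys) + 0#                                     ≈⟨ +-congˡ (sym (others-vanish ps (∈-map⁺ proj₂))) ⟩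
    sumᶜ (map (λ (z , c) → z * det k (c ∷ ys)) ((z , c) ∷ ps))  ≈⟨ sym (linear-combination (det-linear k [] ys) ((z , c) ∷ ps)) ⟩
    det k (combination ((z , c) ∷ ps) ∷ ys)                     ≈⟨ linear-zero (det-linear k [] ys) combination≈0 ⟩
    0#                                                          ∎
    where
    ys = map proj₂ ps
    others-vanish : ∀ qs → (∀ {zc} → zc ∈ qs → proj₂ zc ∈ ys) → sumᶜ (map (λ (z , c) → z * det k (c ∷ ys)) qs) ≈ 0#
    others-vanish []             _   = refl
    others-vanish ((z′ , c′) ∷ qs) ∈ys = begin
      z′ * det k (c′ ∷ ys) + sumᶜ (map (λ (z , c) → z * det k (c ∷ ys)) qs)
        ≈⟨ +-cong (*-congˡ (det-∈ k (∈ys (here ≡.refl)))) (others-vanish qs (∈ys ∘ there)) ⟩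
      z′ * 0# + 0#  ≈⟨ trans (+-congʳ (zeroʳ z′)) (+-identityʳ 0#) ⟩
      0# ∎

  δ : ∀ {k} → Fin k → Fin k → Carrier
  δ i j with i Fin.≟ j
  ... | yes _ = 1#
  ... | no  _ = 0#

  δ-refl : ∀ {k} (i : Fin k) → δ i i ≡ 1#
  δ-refl i with i Fin.≟ i
  ... | yes _   = ≡.refl
  ... | no  i≢i = contradiction ≡.refl i≢i

  δ-≢ : ∀ {k} {i j : Fin k} → i ≢ j → δ i j ≡ 0#
  δ-≢ {i = i} {j} i≢j with i Fin.≟ j
  ... | yes i≡j = contradiction i≡j i≢j
  ... | no  _   = ≡.refl

  δ-suc : ∀ {k} (i j : Fin k) → δ (suc i) (suc j) ≡ δ i j
  δ-suc i j with i Fin.≟ j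
  ... | yes _ = ≡.refl
  ... | no  _ = ≡.refl

  identityColumns : ∀ k → List (Column k)
  identityColumns k = tabulate (λ j → Vec.tabulate (λ i → δ i j))

  expand-heads-zero : ∀ k pre L → All (λ c → head c ≡ 0#) L → expand k pre L ≈ 0#
  expand-heads-zero k pre []      []           = refl
  expand-heads-zero k pre (c ∷ L) (c₀≡0 ∷ L₀≡0) = begin
    head c * det k (tails (pre ++ L)) - expand k (pre ∷ʳ c) L
      ≈⟨ +-cong (*-congʳ (reflexive c₀≡0)) (-‿cong (expand-heads-zero k (pre ∷ʳ c) L L₀≡0)) ⟩
    0# * det k (tails (pre ++ L)) - 0#   ≈⟨ trans (+-cong (zeroˡ _) -0#≈0#) (+-identityʳ 0#) ⟩
    0# ∎

  det-identity : ∀ k → det k (identityColumns k) ≈ 1#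
  det-identity zero    = refl
  det-identity (suc k) = begin
    head first * det k (tails rest) - expand k (first ∷ []) rest
      ≈⟨ +-cong (*-cong (reflexive (δ-refl {suc k} zero)) (reflexive (≡.cong (det k) tails-rest)))
                (-‿cong (expand-heads-zero k (first ∷ []) rest (All.tabulate⁺ (λ j → δ-≢ {i = zero} {suc j} λ ())))) ⟩
    1# * det k (identityColumns k) - 0#  ≈⟨ +-cong (*-congˡ (det-identity k)) -0#≈0# ⟩
    1# * 1# + 0#                         ≈⟨ trans (+-identityʳ _) (*-identityˡ 1#) ⟩
    1# ∎
    where
    first = Vec.tabulate (λ i → δ {suc k} i zero)
    rest  = tabulate (λ j → Vec.tabulate (λ i → δ {suc k} i (suc j)))
    tails-rest : tails rest ≡ identityColumns k
    tails-rest = ≡.trans (map-tabulate _ tail) (tabulate-cong (λ j → Vec.tabulate-cong (λ i → δ-suc i j)))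

module FieldDeterminants (𝔽 : FiniteField) where

  open FiniteField 𝔽
  open FieldProperties 𝔽
  open Polynomials 𝔽
  open Determinants commutativeRing public
  open import Data.Fin using (Fin; zero; suc)
  open import Data.List using ([]; _∷_; _++_; _∷ʳ_; map; tabulate)
  open import Data.List.Properties using (map-++; map-tabulate)
  open import Data.List.Relation.Unary.All as All using (All; []; _∷_)
  import Data.List.Relation.Unary.All.Properties as All
  open import Data.Nat as ℕ using (ℕ; zero; suc)
  open import Data.Nat.Properties using (*-suc)
  open import Data.Product using (_,_; proj₂)
  open import Data.Vec using (Vec; _∷_; head; tail; lookup)
  open import Function using (_∘_)
  open import Relation.Binary.PropositionalEquality

  module _ {E : ℕ} (d : ℕ) where

    EntriesDegree≤ : ∀ {k} → (Vec Carrier E → Column k) → Set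
    EntriesDegree≤ col = ∀ i → Degree≤ E d (λ r → lookup (col r) i)

    private
      at : ∀ {k} → Vec Carrier E → List (Vec Carrier E → Column k) → List (Column k)
      at r = map (λ col → col r)

      tailᶠ : ∀ {k} → (Vec Carrier E → Column (suc k)) → Vec Carrier E → Column k
      tailᶠ col r = tail (col r)

      entries-head : ∀ {k} {col : Vec Carrier E → Column (suc k)} → EntriesDegree≤ col → Degree≤ E d (λ r → head (col r))
      entries-head {col = col} dcol = degree-cong (λ r → head-lookup (col r)) (dcol zero)
        where
        head-lookup : ∀ {k} (v : Column (suc k)) → lookup v zero ≡ head v
        head-lookup (_ ∷ _) = refl

      entries-tail : ∀ {k} {col : Vec Carrier E → Column (suc k)} → EntriesDegree≤ col → EntriesDegree≤ (tailᶠ col)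
      entries-tail {col = col} dcol i = degree-cong (λ r → lookup-suc (col r) i) (dcol (suc i))
        where
        lookup-suc : ∀ {k} (v : Column (suc k)) i → lookup v (suc i) ≡ lookup (tail v) i
        lookup-suc (_ ∷ _) i = refl

      tails-at : ∀ {k} r (cols : List (Vec Carrier E → Column (suc k))) → tails (at r cols) ≡ at r (map tailᶠ cols)
      tails-at r []         = refl
      tails-at r (_ ∷ cols) = cong (_ ∷_) (tails-at r cols)

    mutual
      degree-det : ∀ k (cols : List (Vec Carrier E → Column k)) → All EntriesDegree≤ cols →
                   Degree≤ E (d ℕ.* k) (λ r → det k (at r cols))
      degree-det zero    []      _     = degree-const 1#
      degree-det zero    (_ ∷ _) _     = degree-const 0#
      degree-det (suc k) cols    dcols = degree-expand k [] cols [] dcols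

      degree-expand : ∀ k pre post → All EntriesDegree≤ pre → All EntriesDegree≤ post →
                      Degree≤ E (d ℕ.* suc k) (λ r → expand k (at r pre) (at r post))
      degree-expand k pre []           _    _             = degree-const 0#
      degree-expand k pre (col ∷ post) dpre (dcol ∷ dpost) =
        degree-cong unfold (degree-+ head*minor (degree-neg rest))
        where
        minors = map tailᶠ (pre ++ post)
        head*minor : Degree≤ E (d ℕ.* suc k) (λ r → head (col r) * det k (at r minors))
        head*minor = subst (λ D → Degree≤ E D (λ r → head (col r) * det k (at r minors))) (sym (*-suc d k))
          (degree-* (entries-head {col = col} dcol)
                    (degree-det k minors (All.map⁺ (All.map (λ {c} → entries-tail {col = c}) (All.++⁺ dpre dpost)))))
        rest = degree-expand k (pre ∷ʳ col) post (All.++⁺ dpre (dcol ∷ [])) dpost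
        unfold : ∀ r → head (col r) * det k (at r minors) - expand k (at r (pre ∷ʳ col)) (at r post)
                     ≡ expand k (at r pre) (col r ∷ at r post)
        unfold r = sym (cong₂ (λ cs pre′ → head (col r) * det k cs - expand k pre′ (at r post))
          (trans (cong tails (sym (map-++ _ pre post))) (tails-at r (pre ++ post)))
          (sym (map-++ _ pre (col ∷ []))))

  det-dependent-columns : ∀ k (col : Fin k → Column k) (z : Fin k → Carrier) → 1 ℕ.≤ k → (∀ b → z b ≢ 0#) →
    (∀ a → lookup (combination (tabulate (λ b → z b , col b))) a ≡ 0#) → det k (tabulate col) ≡ 0#
  det-dependent-columns (suc k) col z _ z≢0 combination≡0 = begin
    det (suc k) (col zero ∷ tabulate (col ∘ suc))            ≡⟨ cong (λ cs → det (suc k) (col zero ∷ cs)) (sym (map-tabulate _ proj₂)) ⟩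
    det (suc k) (col zero ∷ map proj₂ (tabulate others))     ≡⟨ x≢0∧x*y≡0⇒y≡0 (z≢0 zero) (det-dependent (z zero) (col zero) (tabulate others) combination≡0) ⟩
    0#                                                       ∎
    where
    open ≡-Reasoning
    others = λ b → z (suc b) , col (suc b)

module FiniteSets where

  open import Data.Bool using (true; false)
  open import Data.Empty using (⊥-elim)
  open import Data.Fin as Fin using (Fin; zero; suc)
  open import Data.Fin.Properties using (injective⇒≤; any?)
  open import Data.Fin.Subset using (Subset; _∈_; ∣_∣; ⊥)
  open import Data.Fin.Subset.Properties using (∣⊥∣≡0; ∉⊥)
  open import Data.List using ([]; _∷_; _++_; map; length; lookup)
  open import Data.List.Properties using (length-map; length-++)
  import Data.List.Membership.Propositional as List
  open import Data.List.Membership.Propositional.Properties using (∈-lookup; ∈-map⁺; ∈-map⁻; ∈-++⁺ˡ; ∈-++⁺ʳ; ∈-++⁻)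
  open import Data.List.Relation.Unary.All as All using ()
  open import Data.List.Relation.Unary.Any as Any using (here; there)
  import Data.List.Relation.Unary.Any.Properties as Any
  open import Data.List.Relation.Unary.AllPairs using (_∷_)
  open import Data.List.Relation.Unary.Unique.Propositional using (Unique)
  open import Data.Nat using (ℕ; zero; suc; _+_; _≤_; s≤s)
  open import Data.Nat.Combinatorics using (_C_; nCk+nC[k+1]≡[n+1]C[k+1])
  open import Data.Nat.Properties using (+-comm; <-irrefl)
  open import Data.Product using (Σ; ∃; _×_; _,_)
  open import Data.Sum using (inj₁; inj₂)
  open import Data.Vec using ([]; _∷_; here; there)
  open import Function using (Injective)
  open import Relation.Binary.PropositionalEquality
  open import Relation.Nullary using (yes; no; contradiction)

  length-unique≤ : ∀ {N} {xs : List (Fin N)} → Unique xs → length xs ≤ N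
  length-unique≤ unique = injective⇒≤ (lookup-injective unique)
    where
    lookup-injective : ∀ {xs : List (Fin _)} → Unique xs → Injective _≡_ _≡_ (lookup xs)
    lookup-injective (_ ∷ _)  {zero}  {zero}  _  = refl
    lookup-injective (x∉ ∷ _) {zero}  {suc j} eq = contradiction eq (All.lookup x∉ (∈-lookup j))
    lookup-injective (x∉ ∷ _) {suc i} {zero}  eq = contradiction (sym eq) (All.lookup x∉ (∈-lookup i))
    lookup-injective (_ ∷ u)  {suc i} {suc j} eq = cong suc (lookup-injective u eq)

  members : ∀ {n} → Subset n → List (Fin n)
  members []          = []
  members (true  ∷ p) = zero ∷ map suc (members p)
  members (false ∷ p) = map suc (members p)

  length-members : ∀ {n} (p : Subset n) → length (members p) ≡ ∣ p ∣
  length-members []          = refl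
  length-members (true  ∷ p) = cong suc (trans (length-map suc (members p)) (length-members p))
  length-members (false ∷ p) = trans (length-map suc (members p)) (length-members p)

  ∈-members : ∀ {n} {i : Fin n} {p} → i ∈ p → i List.∈ members p
  ∈-members {p = true  ∷ p} here       = here refl
  ∈-members {p = true  ∷ p} (there i∈) = there (∈-map⁺ suc (∈-members i∈))
  ∈-members {p = false ∷ p} (there i∈) = ∈-map⁺ suc (∈-members i∈)

  injective-into≤ : ∀ {n j} (X : Subset n) {g : Fin j → Fin n} →
                    Injective _≡_ _≡_ g → (∀ b → g b ∈ X) → j ≤ ∣ X ∣
  injective-into≤ X {g} g-injective g∈X =
    subst (_ ≤_) (length-members X) (injective⇒≤ position-injective)
    where
    position : _ → Fin (length (members X))
    position b = Any.index (∈-members (g∈X b))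
    position-injective : Injective _≡_ _≡_ position
    position-injective {a} {b} eq = g-injective (begin
      g a                              ≡⟨ Any.lookup-index (∈-members (g∈X a)) ⟩
      lookup (members X) (position a)  ≡⟨ cong (lookup (members X)) eq ⟩
      lookup (members X) (position b)  ≡⟨ Any.lookup-index (∈-members (g∈X b)) ⟨
      g b                              ∎)
      where open ≡-Reasoning

  -- Otherwise g would extend by i to an injection of Fin (suc k) into X.
  injective-into-onto : ∀ {n k} (X : Subset n) {g : Fin k → Fin n} →
    Injective _≡_ _≡_ g → (∀ b → g b ∈ X) → ∣ X ∣ ≡ k → ∀ {i} → i ∈ X → ∃ λ b → g b ≡ i
  injective-into-onto {k = k} X {g} g-injective g∈X ∣X∣≡k {i} i∈X with any? (λ b → g b Fin.≟ i)
  ... | yes hit = hit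
  ... | no  miss = contradiction (injective-into≤ X g′-injective g′∈X) (λ k<∣X∣ → <-irrefl (sym ∣X∣≡k) k<∣X∣)
    where
    g′ : Fin (suc k) → Fin _
    g′ zero    = i
    g′ (suc b) = g b
    g′-injective : Injective _≡_ _≡_ g′
    g′-injective {zero}  {zero}  _  = refl
    g′-injective {zero}  {suc b} eq = contradiction (b , sym eq) miss
    g′-injective {suc a} {zero}  eq = contradiction (a , eq) miss
    g′-injective {suc a} {suc b} eq = cong suc (g-injective eq)
    g′∈X : ∀ b → g′ b ∈ X
    g′∈X zero    = i∈X
    g′∈X (suc b) = g∈X b

  subsetsOfSize : ∀ n → ℕ → List (Subset n)
  subsetsOfSize zero    zero    = [] ∷ []
  subsetsOfSize zero    (suc k) = []
  subsetsOfSize (suc n) zero    = map (false ∷_) (subsetsOfSize n zero)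
  subsetsOfSize (suc n) (suc k) = map (false ∷_) (subsetsOfSize n (suc k)) ++ map (true ∷_) (subsetsOfSize n k)

  length-subsetsOfSize : ∀ n k → length (subsetsOfSize n k) ≡ n C k
  length-subsetsOfSize zero    zero    = refl
  length-subsetsOfSize zero    (suc k) = refl
  length-subsetsOfSize (suc n) zero    = trans (length-map _ (subsetsOfSize n zero)) (length-subsetsOfSize n zero)
  length-subsetsOfSize (suc n) (suc k) = begin
    length (map (false ∷_) (subsetsOfSize n (suc k)) ++ map (true ∷_) (subsetsOfSize n k))
      ≡⟨ length-++ (map (false ∷_) (subsetsOfSize n (suc k))) ⟩
    length (map (false ∷_) (subsetsOfSize n (suc k))) + length (map (true ∷_) (subsetsOfSize n k))
      ≡⟨ cong₂ _+_ (length-map _ (subsetsOfSize n (suc k))) (length-map _ (subsetsOfSize n k)) ⟩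
    length (subsetsOfSize n (suc k)) + length (subsetsOfSize n k)
      ≡⟨ cong₂ _+_ (length-subsetsOfSize n (suc k)) (length-subsetsOfSize n k) ⟩
    n C suc k + n C k    ≡⟨ +-comm (n C suc k) (n C k) ⟩
    n C k + n C suc k    ≡⟨ nCk+nC[k+1]≡[n+1]C[k+1] n k ⟩
    suc n C suc k        ∎
    where open ≡-Reasoning

  ∈-subsetsOfSize : ∀ {n} (X : Subset n) → X List.∈ subsetsOfSize n ∣ X ∣
  ∈-subsetsOfSize [] = here refl
  ∈-subsetsOfSize {suc n} (false ∷ X) with ∣ X ∣ | ∈-subsetsOfSize X
  ... | zero  | X∈ = ∈-map⁺ (false ∷_) X∈
  ... | suc k | X∈ = ∈-++⁺ˡ (∈-map⁺ (false ∷_) X∈)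
  ∈-subsetsOfSize {suc n} (true ∷ X) =
    ∈-++⁺ʳ (map (false ∷_) (subsetsOfSize n (suc ∣ X ∣))) (∈-map⁺ (true ∷_) (∈-subsetsOfSize X))

  subsetsOfSize-size : ∀ {n k} (X : Subset n) → X List.∈ subsetsOfSize n k → ∣ X ∣ ≡ k
  subsetsOfSize-size {zero}  {zero}  [] _ = refl
  subsetsOfSize-size {suc n} {zero}  (x ∷ X) X∈ with ∈-map⁻ (false ∷_) X∈
  ... | X′ , X′∈ , refl = subsetsOfSize-size X′ X′∈
  subsetsOfSize-size {suc n} {suc k} (x ∷ X) X∈ with ∈-++⁻ (map (false ∷_) (subsetsOfSize n (suc k))) X∈
  ... | inj₁ X∈₁ with ∈-map⁻ (false ∷_) X∈₁
  ...   | X′ , X′∈ , refl = subsetsOfSize-size X′ X′∈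
  subsetsOfSize-size {suc n} {suc k} (x ∷ X) X∈ | inj₂ X∈₂ with ∈-map⁻ (true ∷_) X∈₂
  ...   | X′ , X′∈ , refl = cong suc (subsetsOfSize-size X′ X′∈)

  subsetOfSize : ∀ {n} (Z : Subset n) k → k ≤ ∣ Z ∣ → Σ (Subset n) λ Y → ∣ Y ∣ ≡ k × (∀ {i} → i ∈ Y → i ∈ Z)
  subsetOfSize {n} Z zero _ = ⊥ , ∣⊥∣≡0 n , λ i∈⊥ → ⊥-elim (∉⊥ i∈⊥)
  subsetOfSize (true ∷ Z) (suc k) (s≤s k≤∣Z∣) with subsetOfSize Z k k≤∣Z∣
  ... | Y , ∣Y∣≡k , Y⊆Z = true ∷ Y , cong suc ∣Y∣≡k , λ { here → here ; (there i∈Y) → there (Y⊆Z i∈Y) }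
  subsetOfSize (false ∷ Z) (suc k) k≤∣Z∣ with subsetOfSize Z (suc k) k≤∣Z∣
  ... | Y , ∣Y∣≡k , Y⊆Z = false ∷ Y , ∣Y∣≡k , λ { (there i∈Y) → there (Y⊆Z i∈Y) }

module Hamming (𝔽 : FiniteField) where

  open FiniteField 𝔽 using (Carrier; _≟_)
  open import Data.Bool using (true; false)
  open import Data.Fin using (zero; suc)
  open import Data.Fin.Subset using (Subset; _∈_; ∣_∣)
  open import Data.Nat using (zero; suc; _+_; _≤_; z≤n; s≤s)
  open import Data.Nat.Properties using (+-suc; +-comm; +-cancelʳ-≤; module ≤-Reasoning)
  open import Data.Vec using (Vec; []; _∷_; here; there; lookup)
  open import Relation.Binary.PropositionalEquality
  open import Relation.Nullary using (yes; no; contradiction)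

  disagreements : ∀ {k} → Vec Carrier k → Vec Carrier k → Subset k
  disagreements []       []       = []
  disagreements (a ∷ xs) (b ∷ ys) with a ≟ b
  ... | yes _ = false ∷ disagreements xs ys
  ... | no  _ = true  ∷ disagreements xs ys

  agreements : ∀ {k} → Vec Carrier k → Vec Carrier k → Subset k
  agreements []       []       = []
  agreements (a ∷ xs) (b ∷ ys) with a ≟ b
  ... | yes _ = true  ∷ agreements xs ys
  ... | no  _ = false ∷ agreements xs ys

  dist≡∣disagreements∣ : ∀ {k} (x y : Vec Carrier k) → dist 𝔽 x y ≡ ∣ disagreements x y ∣
  dist≡∣disagreements∣ []       []       = refl
  dist≡∣disagreements∣ (a ∷ xs) (b ∷ ys) with a ≟ b
  ... | yes _ = dist≡∣disagreements∣ xs ys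
  ... | no  _ = cong suc (dist≡∣disagreements∣ xs ys)

  ∣agreements∣+dist≡k : ∀ {k} (x y : Vec Carrier k) → ∣ agreements x y ∣ + dist 𝔽 x y ≡ k
  ∣agreements∣+dist≡k []       []       = refl
  ∣agreements∣+dist≡k (a ∷ xs) (b ∷ ys) with a ≟ b
  ... | yes _ = cong suc (∣agreements∣+dist≡k xs ys)
  ... | no  _ = trans (+-suc _ _) (cong suc (∣agreements∣+dist≡k xs ys))

  ∈-disagreements⇒≢ : ∀ {k} (x y : Vec Carrier k) {i} → i ∈ disagreements x y → lookup x i ≢ lookup y i
  ∈-disagreements⇒≢ (a ∷ xs) (b ∷ ys) i∈ with a ≟ b
  ∈-disagreements⇒≢ (a ∷ xs) (b ∷ ys) here       | no a≢b = a≢b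
  ∈-disagreements⇒≢ (a ∷ xs) (b ∷ ys) (there i∈) | yes _  = ∈-disagreements⇒≢ xs ys i∈
  ∈-disagreements⇒≢ (a ∷ xs) (b ∷ ys) (there i∈) | no _   = ∈-disagreements⇒≢ xs ys i∈

  ≢⇒∈-disagreements : ∀ {k} (x y : Vec Carrier k) {i} → lookup x i ≢ lookup y i → i ∈ disagreements x y
  ≢⇒∈-disagreements (a ∷ xs) (b ∷ ys) {i}     x≢y with a ≟ b
  ≢⇒∈-disagreements (a ∷ xs) (b ∷ ys) {zero}  a≢b | yes a≡b = contradiction a≡b a≢b
  ≢⇒∈-disagreements (a ∷ xs) (b ∷ ys) {zero}  a≢b | no _    = here
  ≢⇒∈-disagreements (a ∷ xs) (b ∷ ys) {suc i} x≢y | yes _   = there (≢⇒∈-disagreements xs ys x≢y)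
  ≢⇒∈-disagreements (a ∷ xs) (b ∷ ys) {suc i} x≢y | no _    = there (≢⇒∈-disagreements xs ys x≢y)

  ∈-agreements⇒≡ : ∀ {k} (x y : Vec Carrier k) {i} → i ∈ agreements x y → lookup x i ≡ lookup y i
  ∈-agreements⇒≡ (a ∷ xs) (b ∷ ys) i∈ with a ≟ b
  ∈-agreements⇒≡ (a ∷ xs) (b ∷ ys) here       | yes a≡b = a≡b
  ∈-agreements⇒≡ (a ∷ xs) (b ∷ ys) (there i∈) | yes _   = ∈-agreements⇒≡ xs ys i∈
  ∈-agreements⇒≡ (a ∷ xs) (b ∷ ys) (there i∈) | no _    = ∈-agreements⇒≡ xs ys i∈

  dist≡0⇒≡ : ∀ {k} (x y : Vec Carrier k) → dist 𝔽 x y ≡ 0 → x ≡ y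
  dist≡0⇒≡ []       []       _ = refl
  dist≡0⇒≡ (a ∷ xs) (b ∷ ys) d≡0 with a ≟ b
  ... | yes refl = cong (a ∷_) (dist≡0⇒≡ xs ys d≡0)
  dist≡0⇒≡ (a ∷ xs) (b ∷ ys) () | no _

  1≤∣disagreements∣ : ∀ {k} (x y : Vec Carrier k) → x ≢ y → 1 ≤ ∣ disagreements x y ∣
  1≤∣disagreements∣ x y x≢y with ∣ disagreements x y ∣ in ∣D∣≡
  ... | zero  = contradiction (dist≡0⇒≡ x y (trans (dist≡∣disagreements∣ x y) ∣D∣≡)) x≢y
  ... | suc _ = s≤s z≤n

  ∣disagreements∣≤∣agreements∣ : ∀ {k l} (x y : Vec Carrier k) (u v : Vec Carrier l) →
    dist 𝔽 u v + dist 𝔽 x y ≤ l → ∣ disagreements x y ∣ ≤ ∣ agreements u v ∣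
  ∣disagreements∣≤∣agreements∣ {l = l} x y u v close = +-cancelʳ-≤ (dist 𝔽 u v) _ _ (begin
    ∣ disagreements x y ∣ + dist 𝔽 u v   ≡⟨ +-comm _ (dist 𝔽 u v) ⟩
    dist 𝔽 u v + ∣ disagreements x y ∣   ≡⟨ cong (dist 𝔽 u v +_) (dist≡∣disagreements∣ x y) ⟨
    dist 𝔽 u v + dist 𝔽 x y             ≤⟨ close ⟩
    l                                   ≡⟨ ∣agreements∣+dist≡k u v ⟨
    ∣ agreements u v ∣ + dist 𝔽 u v      ∎)
    where open ≤-Reasoning

module Paths {n m : Data.Nat.ℕ} (G : Graph n m) where

  open Graph G
  open FiniteSets using (length-unique≤)
  open import Data.Empty using (⊥; ⊥-elim)
  open import Data.Fin using (Fin)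
  open import Data.List using ([]; _∷_; length)
  open import Data.List.Membership.Propositional using (_∈_)
  open import Data.List.Relation.Unary.All as All using ([])
  open import Data.List.Relation.Unary.Any using (here; there)
  open import Data.List.Relation.Unary.AllPairs using ([]; _∷_)
  open import Data.List.Relation.Unary.Unique.Propositional using (Unique)
  open import Data.Nat using (suc; _≤_; _<_; z≤n; s≤s)
  open import Data.Nat.Properties using (<-irrefl)
  open import Data.Product using (Σ; _,_)
  open import Relation.Binary.PropositionalEquality

  private
    P = Path G

  appendEdge : ∀ {u} e → P u (src e) → P u (tgt e)
  appendEdge e (stop _)    = step e (stop (tgt e))
  appendEdge e (step e′ p) = step e′ (appendEdge e p)

  len-appendEdge : ∀ {u} e (p : P u (src e)) → len G (appendEdge e p) ≡ suc (len G p)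
  len-appendEdge e (stop _)    = refl
  len-appendEdge e (step e′ p) = cong suc (len-appendEdge e p)

  extend : ∀ {u v} e → tgt e ≡ v → P u (src e) → P u v
  extend e refl = appendEdge e

  len-extend : ∀ {u v} e (tgt≡v : tgt e ≡ v) (p : P u (src e)) → len G (extend e tgt≡v p) ≡ suc (len G p)
  len-extend e refl = len-appendEdge e

  edges : ∀ {u w} → P u w → List (Fin E)
  edges (stop _)   = []
  edges (step e p) = e ∷ edges p

  start∈vertices : ∀ {u w} (p : P u w) → u ∈ vertices G p
  start∈vertices (stop _)   = here refl
  start∈vertices (step e p) = here refl

  tgt∈vertices : ∀ {u w e} (p : P u w) → e ∈ edges p → tgt e ∈ vertices G p
  tgt∈vertices (step e p) (here refl) = there (start∈vertices p)
  tgt∈vertices (step e p) (there e∈)  = there (tgt∈vertices p e∈)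

  length-vertices : ∀ {u w} (p : P u w) → length (vertices G p) ≡ suc (len G p)
  length-vertices (stop _)   = refl
  length-vertices (step e p) = cong suc (length-vertices p)

  prefixTo : ∀ {u w v} (p : P u w) → v ∈ vertices G p → P u v
  prefixTo (stop _)   (here refl) = stop _
  prefixTo (step e p) (here refl) = stop _
  prefixTo (step e p) (there v∈)  = step e (prefixTo p v∈)

  prefixThrough : ∀ {u w e} (p : P u w) → e ∈ edges p → Σ (P u (tgt e)) λ q → 1 ≤ len G q
  prefixThrough (step e p) (here refl) = step e (stop _) , s≤s z≤n
  prefixThrough (step e p) (there e∈) with prefixThrough p e∈
  ... | q , _ = step e q , s≤s z≤n

  module _ (acyclic : Acyclic G) where

    no-nonempty-cycle : ∀ {v w} → w ≡ v → (p : P v w) → 1 ≤ len G p → ⊥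
    no-nonempty-cycle {v} refl p 1≤len = <-irrefl (sym (acyclic v p)) 1≤len

    vertices-unique : ∀ {u w} (p : P u w) → Unique (vertices G p)
    vertices-unique (stop _)   = [] ∷ []
    vertices-unique (step e p) =
      All.tabulate (λ v∈p src≡v → no-nonempty-cycle (sym src≡v) (step e (prefixTo p v∈p)) (s≤s z≤n))
      ∷ vertices-unique p

    len<N : ∀ {u w} (p : P u w) → len G p < N
    len<N p = subst (_≤ N) (length-vertices p) (length-unique≤ (vertices-unique p))

    tgt-injective-on-edges : ∀ {u w e e′} (p : P u w) → e ∈ edges p → e′ ∈ edges p → tgt e ≡ tgt e′ → e ≡ e′
    tgt-injective-on-edges (step e₀ p) (here refl) (here refl) _ = refl
    tgt-injective-on-edges (step e₀ p) (here refl) (there e′∈) eq with prefixThrough p e′∈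
    ... | q , 1≤q = ⊥-elim (no-nonempty-cycle (sym eq) q 1≤q)
    tgt-injective-on-edges (step e₀ p) (there e∈) (here refl) eq with prefixThrough p e∈
    ... | q , 1≤q = ⊥-elim (no-nonempty-cycle eq q 1≤q)
    tgt-injective-on-edges (step e₀ p) (there e∈) (there e′∈) eq = tgt-injective-on-edges p e∈ e′∈ eq

module Circuits (𝔽 : FiniteField) {n m : Data.Nat.ℕ} (G : Graph n m) where

  open FiniteField 𝔽
  open FieldProperties 𝔽
  open Polynomials 𝔽
  open FieldDeterminants 𝔽 using (Linear; lincomb; δ; δ-≢)
  open Graph G
  open Paths G using (extend; len-extend)
  open import Data.Empty using (⊥)
  open import Data.Fin as Fin using (Fin; zero; suc)
  open import Data.Fin.Properties using (suc-injective)
  open import Data.Maybe using (just; nothing)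
  open import Data.Nat as ℕ using (zero; suc; _≤_)
  open import Data.Vec as Vec using (Vec; lookup)
  import Data.Vec.Properties as Vec
  open import Function using (_∘_)
  open import Relation.Binary.PropositionalEquality
  open import Relation.Nullary using (yes; no; contradiction)

  private
    P = Path G
    value′ = value 𝔽 G
    findInput′ = findInput 𝔽 G
    sumInto′ = sumInto 𝔽 G

  findInput-just : ∀ {k} (f : Fin k → Fin N) v {i} → findInput′ f v ≡ just i → f i ≡ v
  findInput-just {suc k} f v eq with f zero Fin.≟ v
  findInput-just {suc k} f v {zero} refl | yes fi≡v = fi≡v
  ... | no _ with findInput′ (f ∘ suc) v in eq′
  findInput-just {suc k} f v {suc i} refl | no _ | just .i = findInput-just (f ∘ suc) v eq′

  findInput-nothing : ∀ {k} (f : Fin k → Fin N) v → findInput′ f v ≡ nothing → ∀ i → f i ≢ v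
  findInput-nothing {suc k} f v eq i with f zero Fin.≟ v
  findInput-nothing {suc k} f v () i | yes _
  ... | no f0≢v with findInput′ (f ∘ suc) v in eq′
  findInput-nothing {suc k} f v refl zero    | no f0≢v | nothing = f0≢v
  findInput-nothing {suc k} f v refl (suc i) | no f0≢v | nothing = findInput-nothing (f ∘ suc) v eq′ i

  findInput-none : ∀ {k} (f : Fin k → Fin N) v → (∀ i → f i ≢ v) → findInput′ f v ≡ nothing
  findInput-none f v f≢v with findInput′ f v in eq
  ... | just i  = contradiction (findInput-just f v eq) (f≢v i)
  ... | nothing = refl

  findInput-inp : ∀ i → findInput′ inp (inp i) ≡ just i
  findInput-inp i with findInput′ inp (inp i) in eq
  ... | just i′  = cong just (inp-inj (findInput-just inp (inp i) eq))
  ... | nothing = contradiction refl (findInput-nothing inp (inp i) eq i)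

  sumInto-linear : ∀ {k} (es : Fin k → Fin E) v {α β} {g h w : Fin k → Carrier} →
    (∀ j → w j ≡ α * g j + β * h j) → sumInto′ es v w ≡ α * sumInto′ es v g + β * sumInto′ es v h
  sumInto-linear {zero}  es v {α} {β} _ = sym (trans (cong₂ _+_ (zeroʳ α) (zeroʳ β)) (+-identityʳ 0#))
  sumInto-linear {suc k} es v {α} {β} {g} {h} {w} w≡ with tgt (es zero) Fin.≟ v
  ... | yes _ = begin
    w zero + sumInto′ (es ∘ suc) v (w ∘ suc)
      ≡⟨ cong₂ _+_ (w≡ zero) (sumInto-linear (es ∘ suc) v (w≡ ∘ suc)) ⟩
    (α * g zero + β * h zero) + (α * G′ + β * H′)
      ≡⟨ solve 6 (λ α β g h G H → (α :* g :+ β :* h) :+ (α :* G :+ β :* H) := α :* (g :+ G) :+ β :* (h :+ H))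
               refl α β (g zero) (h zero) G′ H′ ⟩
    α * (g zero + G′) + β * (h zero + H′) ∎
    where
    open ≡-Reasoning
    G′ = sumInto′ (es ∘ suc) v (g ∘ suc)
    H′ = sumInto′ (es ∘ suc) v (h ∘ suc)
  ... | no _ = sumInto-linear (es ∘ suc) v (w≡ ∘ suc)

  sumInto-zero : ∀ {k} (es : Fin k → Fin E) v {g : Fin k → Carrier} →
    (∀ j → tgt (es j) ≡ v → g j ≡ 0#) → sumInto′ es v g ≡ 0#
  sumInto-zero {zero}  es v _   = refl
  sumInto-zero {suc k} es v g≡0 with tgt (es zero) Fin.≟ v
  ... | yes into = trans (cong₂ _+_ (g≡0 zero into) (sumInto-zero (es ∘ suc) v (g≡0 ∘ suc))) (+-identityˡ 0#)
  ... | no  _    = sumInto-zero (es ∘ suc) v (g≡0 ∘ suc)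

  sumInto-single : ∀ {k} (es : Fin k → Fin E) v {g : Fin k → Carrier} j₀ → tgt (es j₀) ≡ v →
    (∀ j → tgt (es j) ≡ v → j ≢ j₀ → g j ≡ 0#) → sumInto′ es v g ≡ g j₀
  sumInto-single {suc k} es v j₀ into₀ others with tgt (es zero) Fin.≟ v
  sumInto-single {suc k} es v {g} zero    into₀ others | yes _ =
    trans (cong (g zero +_) (sumInto-zero (es ∘ suc) v (λ j into → others (suc j) into λ ()))) (+-identityʳ _)
  sumInto-single {suc k} es v     (suc j₀) into₀ others | yes into =
    trans (cong₂ _+_ (others zero into λ ()) (sumInto-single (es ∘ suc) v j₀ into₀ (λ j into j≢j₀ → others (suc j) into (j≢j₀ ∘ suc-injective))))
          (+-identityˡ _)
  sumInto-single {suc k} es v zero     into₀ others | no ¬into = contradiction into₀ ¬into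
  sumInto-single {suc k} es v (suc j₀) into₀ others | no _     =
    sumInto-single (es ∘ suc) v j₀ into₀ (λ j into j≢j₀ → others (suc j) into (j≢j₀ ∘ suc-injective))

  degree-sumInto : ∀ {k K D} (es : Fin k → Fin E) v (g : Vec Carrier K → Fin k → Carrier) →
    (∀ j → tgt (es j) ≡ v → Degree≤ K D (λ r → g r j)) → Degree≤ K D (λ r → sumInto′ es v (g r))
  degree-sumInto {zero}  es v g _     = degree-const 0#
  degree-sumInto {suc k} es v g deg-g with tgt (es zero) Fin.≟ v
  ... | yes into = degree-+ (deg-g zero into) (degree-sumInto (es ∘ suc) v (λ r → g r ∘ suc) (deg-g ∘ suc))
  ... | no  _    = degree-sumInto (es ∘ suc) v (λ r → g r ∘ suc) (deg-g ∘ suc)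

  value-linear : ∀ r fuel v → Linear (λ x → value′ r x fuel v)
  value-linear r fuel v {α} {β} w≈ with findInput′ inp v
  value-linear r fuel       v (lincomb w≈) | just i  = w≈ i
  value-linear r zero       v {α} {β} _    | nothing = sym (trans (cong₂ _+_ (zeroʳ α) (zeroʳ β)) (+-identityʳ 0#))
  value-linear r (suc fuel) v {α} {β} w≈   | nothing = sumInto-linear (λ e → e) v λ e →
    trans (cong (lookup r e *_) (value-linear r fuel (src e) w≈))
          (solve 5 (λ ρ α β X Y → ρ :* (α :* X :+ β :* Y) := α :* (ρ :* X) :+ β :* (ρ :* Y)) refl (lookup r e) α β _ _)

  unit : Fin n → Vec Carrier n
  unit i = Vec.tabulate (λ j → δ j i)

  lookup-unit : ∀ i j → lookup (unit i) j ≡ δ j i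
  lookup-unit i = Vec.lookup∘tabulate (λ j → δ j i)

  value-unreachable : ∀ fuel v i → (P (inp i) v → ⊥) → ∀ r → value′ r (unit i) fuel v ≡ 0#
  value-unreachable fuel v i unreachable r with findInput′ inp v in eq
  ... | just i′ with i′ Fin.≟ i
  ...   | yes refl = contradiction (subst (P (inp i)) (findInput-just inp v eq) (stop _)) unreachable
  ...   | no i′≢i  = trans (lookup-unit i i′) (δ-≢ i′≢i)
  value-unreachable zero       v i unreachable r | nothing = refl
  value-unreachable (suc fuel) v i unreachable r | nothing = sumInto-zero (λ e → e) v λ e into →
    trans (cong (lookup r e *_) (value-unreachable fuel (src e) i (unreachable ∘ extend e into) r)) (zeroʳ _)

  degree-value : ∀ fuel v i D → (∀ (p : P (inp i) v) → len G p ≤ D) → Degree≤ E D (λ r → value′ r (unit i) fuel v)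
  degree-value fuel v i D bound with findInput′ inp v
  ... | just i′ = degree-const _
  degree-value zero       v i D bound | nothing = degree-const 0#
  degree-value (suc fuel) v i D bound | nothing =
    degree-sumInto (λ e → e) v (λ r e → lookup r e * value′ r (unit i) fuel (src e)) (edge-term D bound)
    where
    edge-term : ∀ D → (∀ (p : P (inp i) v) → len G p ≤ D) → ∀ e → tgt e ≡ v →
      Degree≤ E D (λ r → lookup r e * value′ r (unit i) fuel (src e))
    edge-term zero bound e into = degree-cong
      (λ r → sym (trans (cong (lookup r e *_) (value-unreachable fuel (src e) i no-path r)) (zeroʳ _)))
      (degree-const 0#)
      where
      no-path : P (inp i) (src e) → ⊥
      no-path p with subst (_≤ 0) (len-extend e into p) (bound (extend e into p))
      ... | ()
    edge-term (suc D) bound e into = degree-* (degree-lookup e)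
      (degree-value fuel (src e) i D λ p → ℕ.≤-pred (subst (_≤ suc D) (len-extend e into p) (bound (extend e into p))))

module PathMatrix (𝔽 : FiniteField) {n m : Data.Nat.ℕ} (G : Graph n m) (dag : IsDAG G)
  {X : Data.Fin.Subset.Subset n} {Y : Data.Fin.Subset.Subset m} {k : Data.Nat.ℕ}
  (paths : DisjointPaths G X Y k) where

  open FiniteField 𝔽
  open FieldProperties 𝔽
  open Polynomials 𝔽
  open FieldDeterminants 𝔽
  open Circuits 𝔽 G
  open Graph G
  open Paths G
  open DisjointPaths paths
  open FiniteSets using (injective-into-onto)
  open import Data.Empty using (⊥-elim)
  open import Data.Fin as Fin using (Fin)
  open import Data.Fin.Properties using (any?)
  open import Data.Fin.Subset using (_∈_; ∣_∣)
  open import Data.List using (map; tabulate)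
  open import Data.List.Properties using (map-tabulate; tabulate-cong)
  import Data.List.Membership.Propositional as List
  import Data.List.Relation.Unary.All.Properties as All
  open import Data.List.Relation.Unary.Any using (here; there)
  open import Data.Nat as ℕ using (ℕ; suc; _≤_; s≤s)
  import Data.Nat.Properties as ℕ
  open import Data.Product using (∃; _×_; _,_; proj₁; proj₂)
  open import Data.Vec as Vec using (Vec; lookup)
  import Data.Vec.Properties as Vec
  open import Function using (Injective; _∘_; id)
  open import Relation.Binary.PropositionalEquality
  open import Relation.Nullary using (Dec; yes; no; contradiction)

  open import Data.List.Membership.DecPropositional (Fin._≟_ {E}) using (_∈?_)

  private
    P = Path G
    acyclic = proj₁ dag

  s-injective : Injective _≡_ _≡_ s
  s-injective {a} {b} sa≡sb with a Fin.≟ b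
  ... | yes a≡b = a≡b
  ... | no  a≢b = ⊥-elim (disj a b a≢b (inp (s a)) (start∈vertices (path a))
                            (subst (λ i → inp i List.∈ vertices G (path b)) (sym sa≡sb) (start∈vertices (path b))))

  δ-s : ∀ a b → δ (s a) (s b) ≡ δ a b
  δ-s a b with a Fin.≟ b
  ... | yes refl = δ-refl (s a)
  ... | no  a≢b  = δ-≢ (a≢b ∘ s-injective)

  OnPaths : Fin E → Set
  OnPaths e = ∃ λ a → e List.∈ edges (path a)

  onPaths? : ∀ e → Dec (OnPaths e)
  onPaths? e = any? (λ a → e ∈? edges (path a))

  indicator : ∀ {A : Set} → Dec A → Carrier
  indicator (yes _) = 1#
  indicator (no  _) = 0#

  r₀ : Vec Carrier E
  r₀ = Vec.tabulate (indicator ∘ onPaths?)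

  r₀-on-path : ∀ {a e} → e List.∈ edges (path a) → lookup r₀ e ≡ 1#
  r₀-on-path {a} {e} e∈ rewrite Vec.lookup∘tabulate (indicator ∘ onPaths?) e with onPaths? e
  ... | yes _   = refl
  ... | no  off = contradiction (a , e∈) off

  -- The paths are vertex-disjoint, and in a DAG no path enters a vertex twice.
  r₀-competitor : ∀ {a e e′} → e List.∈ edges (path a) → tgt e′ ≡ tgt e → e′ ≢ e → lookup r₀ e′ ≡ 0#
  r₀-competitor {a} {e} {e′} e∈ same-tgt e′≢e rewrite Vec.lookup∘tabulate (indicator ∘ onPaths?) e′ with onPaths? e′
  ... | no  _          = refl
  ... | yes (b , e′∈) with a Fin.≟ b
  ...   | yes refl = contradiction (tgt-injective-on-edges acyclic (path a) e′∈ e∈ same-tgt) e′≢e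
  ...   | no  a≢b  = ⊥-elim (disj a b a≢b (tgt e) (tgt∈vertices (path a) e∈)
                                (subst (List._∈ vertices G (path b)) same-tgt (tgt∈vertices (path b) e′∈)))

  module _ (x : Vec Carrier n) where

    Settled : ℕ → Fin N → Carrier → Set
    Settled f₀ v c = ∀ f → f₀ ≤ f → value 𝔽 G r₀ x f v ≡ c

    settled-input : ∀ i → Settled 0 (inp i) (lookup x i)
    settled-input i f _ rewrite findInput-inp i = refl

    settled-edge : ∀ {a e f₀ c} → e List.∈ edges (path a) → Settled f₀ (src e) c → Settled (suc f₀) (tgt e) c
    settled-edge {a} {e} {f₀} {c} e∈ settled (suc f) (s≤s f₀≤f)
      rewrite findInput-none inp (tgt e) (λ i inp≡tgt → proj₂ dag i e (sym inp≡tgt)) = begin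
      sumInto 𝔽 G id (tgt e) (λ e′ → lookup r₀ e′ * value 𝔽 G r₀ x f (src e′))
        ≡⟨ sumInto-single id (tgt e) e refl (λ e′ same-tgt e′≢e →
             trans (cong (_* value 𝔽 G r₀ x f (src e′)) (r₀-competitor e∈ same-tgt e′≢e)) (zeroˡ _)) ⟩
      lookup r₀ e * value 𝔽 G r₀ x f (src e)  ≡⟨ cong₂ _*_ (r₀-on-path e∈) (settled f f₀≤f) ⟩
      1# * c                                 ≡⟨ *-identityˡ c ⟩
      c                                      ∎
      where open ≡-Reasoning

    settled-along : ∀ {a u w f₀ c} (q : P u w) → (∀ {e} → e List.∈ edges q → e List.∈ edges (path a)) →
                    Settled f₀ u c → Settled (f₀ ℕ.+ len G q) w c
    settled-along {w = w} {f₀} {c} (stop _)   _  settled = subst (λ f → Settled f w c) (sym (ℕ.+-identityʳ f₀)) settled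
    settled-along {w = w} {f₀} {c} (step e q) on settled = subst (λ f → Settled f w c) (sym (ℕ.+-suc f₀ (len G q)))
      (settled-along q (on ∘ there) (settled-edge (on (here refl)) settled))

  column : Fin k → Vec Carrier E → Column k
  column b r = Vec.tabulate (λ a → value 𝔽 G r (unit (s b)) N (out (t a)))

  lookup-column : ∀ b r a → lookup (column b r) a ≡ value 𝔽 G r (unit (s b)) N (out (t a))
  lookup-column b r = Vec.lookup∘tabulate (λ a → value 𝔽 G r (unit (s b)) N (out (t a)))

  entry-r₀ : ∀ a b → value 𝔽 G r₀ (unit (s b)) N (out (t a)) ≡ δ a b
  entry-r₀ a b = begin
    value 𝔽 G r₀ (unit (s b)) N (out (t a)) ≡⟨ settled-along (unit (s b)) (path a) id (settled-input (unit (s b)) (s a)) N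
                                                 (ℕ.<⇒≤ (len<N acyclic (path a))) ⟩
    lookup (unit (s b)) (s a)               ≡⟨ lookup-unit (s b) (s a) ⟩
    δ (s a) (s b)                           ≡⟨ δ-s a b ⟩
    δ a b                                   ∎
    where open ≡-Reasoning

  pathDet : Vec Carrier E → Carrier
  pathDet r = det k (map (λ col → col r) (tabulate column))

  pathDet-r₀ : pathDet r₀ ≡ 1#
  pathDet-r₀ = begin
    det k (map (λ col → col r₀) (tabulate column))
      ≡⟨ cong (det k) (trans (map-tabulate column (λ col → col r₀)) (tabulate-cong λ b → Vec.tabulate-cong λ a → entry-r₀ a b)) ⟩
    det k (identityColumns k) ≡⟨ det-identity k ⟩
    1#                        ∎
    where open ≡-Reasoning

  degree-pathDet : ∀ {d} → HasDepth G d → Degree≤ E (d ℕ.* k) pathDet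
  degree-pathDet {d} depth = degree-det d k (tabulate column) (All.tabulate⁺ λ b a →
    degree-cong (λ r → sym (lookup-column b r a))
      (degree-value N (out (t a)) (s b) d (proj₁ depth (s b) (t a))))

  private
    1x-1y≡x-y : ∀ x y → 1# * x + - 1# * y ≡ x - y
    1x-1y≡x-y x y = cong₂ _+_ (*-identityˡ x) (-1*x≈-x y)

  module Dependence (r : Vec Carrier E) {x y : Vec Carrier n} (∣X∣≡k : ∣ X ∣ ≡ k)
    (X⇒≢ : ∀ {i} → i ∈ X → lookup x i ≢ lookup y i) (≢⇒X : ∀ {i} → lookup x i ≢ lookup y i → i ∈ X) where

    z : Fin k → Carrier
    z b = lookup x (s b) - lookup y (s b)

    z≢0 : ∀ b → z b ≢ 0#
    z≢0 b z≡0 = X⇒≢ (s∈X b) (x∙y⁻¹≈ε⇒x≈y _ _ z≡0)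

    inputs : List (Carrier × Column n)
    inputs = tabulate (λ b → z b , unit (s b))

    -- s maps onto X, and outside X the vectors x and y agree.
    combination-inputs : ∀ i → lookup (combination inputs) i ≡ 1# * lookup x i + - 1# * lookup y i
    combination-inputs i = begin
      lookup (combination inputs) i                        ≡⟨ linear-combination (lookup-linear {n} i) inputs ⟩
      sumᶜ (map (λ (z , u) → z * lookup u i) inputs)       ≡⟨ cong sumᶜ (map-tabulate (λ b → z b , unit (s b)) _) ⟩
      sumᶜ (tabulate (λ b → z b * lookup (unit (s b)) i))  ≡⟨ by-cases ⟩
      lookup x i - lookup y i                              ≡⟨ 1x-1y≡x-y _ _ ⟨
      1# * lookup x i + - 1# * lookup y i                  ∎
      where
      open ≡-Reasoning
      term≡0 : ∀ {b} → s b ≢ i → z b * lookup (unit (s b)) i ≡ 0#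
      term≡0 {b} sb≢i = trans (cong (z b *_) (trans (lookup-unit (s b) i) (δ-≢ (sb≢i ∘ sym)))) (zeroʳ _)
      by-cases : sumᶜ (tabulate (λ b → z b * lookup (unit (s b)) i)) ≡ lookup x i - lookup y i
      by-cases with any? (λ b → s b Fin.≟ i)
      ... | yes (b₀ , refl) = begin
        sumᶜ (tabulate (λ b → z b * lookup (unit (s b)) (s b₀)))
          ≡⟨ sumᶜ-tabulate-single _ b₀ (λ b b≢b₀ → term≡0 (b≢b₀ ∘ s-injective)) ⟩
        z b₀ * lookup (unit (s b₀)) (s b₀)   ≡⟨ cong (z b₀ *_) (trans (lookup-unit (s b₀) (s b₀)) (δ-refl (s b₀))) ⟩
        z b₀ * 1#                            ≡⟨ *-identityʳ (z b₀) ⟩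
        z b₀                                 ∎
      ... | no  missed with lookup x i ≟ lookup y i
      ...   | no  xᵢ≢yᵢ = contradiction (injective-into-onto X s-injective s∈X ∣X∣≡k (≢⇒X xᵢ≢yᵢ)) missed
      ...   | yes xᵢ≡yᵢ = begin
        sumᶜ (tabulate (λ b → z b * lookup (unit (s b)) i)) ≡⟨ sumᶜ-tabulate-zero _ (λ b → term≡0 (λ sb≡i → missed (b , sb≡i))) ⟩
        0#                                                ≡⟨ sym (-‿inverseʳ (lookup y i)) ⟩
        lookup y i - lookup y i                           ≡⟨ cong (_- lookup y i) (sym xᵢ≡yᵢ) ⟩
        lookup x i - lookup y i                           ∎

    combination-columns : ∀ a → lookup (combination (tabulate (λ b → z b , column b r))) a ≡
                                value 𝔽 G r x N (out (t a)) - value 𝔽 G r y N (out (t a))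
    combination-columns a = begin
      lookup (combination (tabulate (λ b → z b , column b r))) a
        ≡⟨ linear-combination (lookup-linear {k} a) (tabulate (λ b → z b , column b r)) ⟩
      sumᶜ (map (λ (z , c) → z * lookup c a) (tabulate (λ b → z b , column b r)))
        ≡⟨ cong sumᶜ (trans (map-tabulate _ _) (tabulate-cong λ b → cong (z b *_) (lookup-column b r a))) ⟩
      sumᶜ (tabulate (λ b → z b * value 𝔽 G r (unit (s b)) N v))
        ≡⟨ cong sumᶜ (map-tabulate (λ b → z b , unit (s b)) (λ (z , u) → z * value 𝔽 G r u N v)) ⟨
      sumᶜ (map (λ (z , u) → z * value 𝔽 G r u N v) inputs)
        ≡⟨ linear-combination (value-linear r N v) inputs ⟨
      value 𝔽 G r (combination inputs) N v
        ≡⟨ value-linear r N v (lincomb combination-inputs) ⟩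
      1# * value 𝔽 G r x N v + - 1# * value 𝔽 G r y N v
        ≡⟨ 1x-1y≡x-y _ _ ⟩
      value 𝔽 G r x N v - value 𝔽 G r y N v ∎
      where
      open ≡-Reasoning
      v = out (t a)

  pathDet-singular : ∀ r {x y : Vec Carrier n} → ∣ X ∣ ≡ k → 1 ℕ.≤ k →
    (∀ {i} → i ∈ X → lookup x i ≢ lookup y i) → (∀ {i} → lookup x i ≢ lookup y i → i ∈ X) →
    (∀ {j} → j ∈ Y → value 𝔽 G r x N (out j) ≡ value 𝔽 G r y N (out j)) → pathDet r ≡ 0#
  pathDet-singular r {x} {y} ∣X∣≡k 1≤k X⇒≢ ≢⇒X agree = begin
    det k (map (λ col → col r) (tabulate column)) ≡⟨ cong (det k) (map-tabulate column (λ col → col r)) ⟩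
    det k (tabulate (λ b → column b r))           ≡⟨ det-dependent-columns k (λ b → column b r) z 1≤k z≢0 dependent ⟩
    0#                                            ∎
    where
    open ≡-Reasoning
    open Dependence r {x} {y} ∣X∣≡k X⇒≢ ≢⇒X
    dependent : ∀ a → lookup (combination (tabulate (λ b → z b , column b r))) a ≡ 0#
    dependent a = trans (combination-columns a) (trans (cong (_- value 𝔽 G r y N (out (t a))) (agree (t∈Y a))) (-‿inverseʳ _))

module Main (𝔽 : FiniteField) {n m d : Data.Nat.ℕ} (G : Graph n m)
  (superconcentrator : IsSuperconcentrator G) (depth : HasDepth G d) where

  open FiniteField 𝔽
  open FieldProperties 𝔽
  open SchwartzZippel 𝔽 using (zeros; schwartz-zippel)
  open Hamming 𝔽
  open Counting
  open FiniteSets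
  open Graph G using (E; N; out)
  open import Data.Fin.Subset using (Subset; _∈_; ∣_∣)
  open import Data.Fin.Subset.Properties using (∣p∣≤n)
  open import Data.List using (map; filter; length; concatMap; cartesianProduct; applyUpTo)
  open import Data.List.Membership.Propositional as List using (lose)
  open import Data.List.Membership.Propositional.Properties
    using (∈-concatMap⁺; ∈-applyUpTo⁺; ∈-cartesianProduct⁺; ∈-cartesianProduct⁻)
  open import Data.List.Relation.Unary.All as All using (All)
  import Data.List.Relation.Unary.All.Properties as All
  open import Data.List.Relation.Unary.Any using (Any; any?)
  open import Data.List.Relation.Unary.Unique.Propositional using (Unique)
  import Data.List.Relation.Unary.Unique.Propositional.Properties as Unique
  open import Data.Nat as ℕ using (ℕ; suc; _≤_)
  import Data.Nat.Properties as ℕ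
  open import Data.Nat.Combinatorics using (_C_)
  open import Data.Nat.ListAction using (sum)
  open import Data.Product using (Σ; _×_; _,_; proj₁; proj₂)
  open import Data.Vec as Vec using (Vec)
  import Data.Vec.Properties as Vec
  open import Function using (_∘_)
  open import Relation.Binary.PropositionalEquality
  open import Relation.Nullary using (¬_; yes; no; contradiction)
  open import Relation.Unary using (Decidable)
  open import Relation.Unary.Properties using (∁?)

  private
    q = size
    dag = proj₁ superconcentrator

  pathsFor : (X : Subset n) (Y : Subset m) → ∣ X ∣ ≡ ∣ Y ∣ → DisjointPaths G X Y ∣ X ∣
  pathsFor X Y ∣X∣≡∣Y∣ = proj₁ (proj₂ superconcentrator X Y ∣X∣≡∣Y∣)

  module PathMatrixFor X Y (∣X∣≡∣Y∣ : ∣ X ∣ ≡ ∣ Y ∣) = PathMatrix 𝔽 G dag (pathsFor X Y ∣X∣≡∣Y∣)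
  open PathMatrixFor using (pathDet)

  Singular : Subset n × Subset m → Vec Carrier E → Set
  Singular (X , Y) r = Σ (∣ X ∣ ≡ ∣ Y ∣) λ ∣X∣≡∣Y∣ → pathDet X Y ∣X∣≡∣Y∣ r ≡ 0#

  singular? : ∀ XY → Decidable (Singular XY)
  singular? (X , Y) r with ∣ X ∣ ℕ.≟ ∣ Y ∣
  ... | no  ∣X∣≢∣Y∣ = no (∣X∣≢∣Y∣ ∘ proj₁)
  ... | yes ∣X∣≡∣Y∣ with pathDet X Y ∣X∣≡∣Y∣ r ≟ 0#
  ...   | yes det≡0 = yes (∣X∣≡∣Y∣ , det≡0)
  ...   | no  det≢0 = no λ (eq , det≡0) → det≢0 (subst (λ eq → pathDet X Y eq r ≡ 0#) (ℕ.≡-irrelevant eq ∣X∣≡∣Y∣) det≡0)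

  pairsOfSize : ℕ → List (Subset n × Subset m)
  pairsOfSize k = cartesianProduct (subsetsOfSize n k) (subsetsOfSize m k)

  pairs : List (Subset n × Subset m)
  pairs = concatMap pairsOfSize (applyUpTo suc n)

  bad? : Decidable (λ r → Any (λ XY → Singular XY r) pairs)
  bad? r = any? (λ XY → singular? XY r) pairs

  good : List (Vec Carrier E)
  good = filter (∁? bad?) (vectors E)

  good-unique : Unique good
  good-unique = Unique.filter⁺ (∁? bad?) (vectors-unique elements-unique E)

  ∈-pairs : ∀ {X Y} → ∣ X ∣ ≡ ∣ Y ∣ → 1 ≤ ∣ X ∣ → (X , Y) List.∈ pairs
  ∈-pairs {X} {Y} ∣X∣≡∣Y∣ 1≤∣X∣ = ∈-concatMap⁺ pairsOfSize (lose (size∈sizes 1≤∣X∣ (∣p∣≤n X)) XY∈pairs)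
    where
    size∈sizes : ∀ {k} → 1 ≤ k → k ≤ n → k List.∈ applyUpTo suc n
    size∈sizes {suc k} _ k<n = ∈-applyUpTo⁺ suc k<n
    XY∈pairs : (X , Y) List.∈ pairsOfSize ∣ X ∣
    XY∈pairs = ∈-cartesianProduct⁺ (∈-subsetsOfSize X)
      (subst (λ k → Y List.∈ subsetsOfSize m k) (sym ∣X∣≡∣Y∣) (∈-subsetsOfSize Y))

  -- X: the inputs where x and y differ; Y: as many outputs where C x and C y agree.
  collision⇒singular : ∀ r {x y} → x ≢ y →
    dist 𝔽 (circuit 𝔽 G r x) (circuit 𝔽 G r y) ℕ.+ dist 𝔽 x y ≤ m → Any (λ XY → Singular XY r) pairs
  collision⇒singular r {x} {y} x≢y close =
    witness (subsetOfSize (agreements Cx Cy) ∣ X ∣ (∣disagreements∣≤∣agreements∣ x y Cx Cy close))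
    where
    Cx = circuit 𝔽 G r x
    Cy = circuit 𝔽 G r y
    X = disagreements x y
    1≤∣X∣ = 1≤∣disagreements∣ x y x≢y
    witness : Σ (Subset m) (λ Y → ∣ Y ∣ ≡ ∣ X ∣ × (∀ {j} → j ∈ Y → j ∈ agreements Cx Cy)) →
              Any (λ XY → Singular XY r) pairs
    witness (Y , ∣Y∣≡∣X∣ , Y⊆agreements) = lose (∈-pairs {X} {Y} (sym ∣Y∣≡∣X∣) 1≤∣X∣)
      (sym ∣Y∣≡∣X∣ , PathMatrixFor.pathDet-singular X Y (sym ∣Y∣≡∣X∣) r refl 1≤∣X∣
                       (∈-disagreements⇒≢ x y) (≢⇒∈-disagreements x y) agree)
      where
      agree : ∀ {j} → j ∈ Y → value 𝔽 G r x N (out j) ≡ value 𝔽 G r y N (out j)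
      agree {j} j∈Y = trans (sym (Vec.lookup∘tabulate _ j))
                            (trans (∈-agreements⇒≡ Cx Cy (Y⊆agreements j∈Y)) (Vec.lookup∘tabulate _ j))

  good-isSICode : All (λ r → IsSICode 𝔽 (circuit 𝔽 G r)) good
  good-isSICode = All.map nonsingular⇒isSICode (All.all-filter (∁? bad?) (vectors E))
    where
    nonsingular⇒isSICode : ∀ {r} → ¬ Any (λ XY → Singular XY r) pairs → IsSICode 𝔽 (circuit 𝔽 G r)
    nonsingular⇒isSICode {r} nonsingular x y x≢y with suc m ℕ.≤? dist 𝔽 (circuit 𝔽 G r x) (circuit 𝔽 G r y) ℕ.+ dist 𝔽 x y
    ... | yes long = long
    ... | no  ¬long = contradiction (collision⇒singular r x≢y (ℕ.≤-pred (ℕ.≰⇒> ¬long))) nonsingular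

  singular-count : ∀ {k X Y} → X List.∈ subsetsOfSize n k → Y List.∈ subsetsOfSize m k →
    count (singular? (X , Y)) (vectors E) ℕ.* q ≤ d ℕ.* k ℕ.* q ℕ.^ E
  singular-count {k} {X} {Y} X∈ Y∈ = begin
    count (singular? (X , Y)) (vectors E) ℕ.* q
      ≤⟨ ℕ.*-monoˡ-≤ q (count-mono _ _ (vectors E) (All.tabulate λ _ (eq , det≡0) →
           subst (λ eq → pathDet X Y eq _ ≡ 0#) (ℕ.≡-irrelevant eq ∣X∣≡∣Y∣) det≡0)) ⟩
    zeros (pathDet X Y ∣X∣≡∣Y∣) ℕ.* q
      ≤⟨ schwartz-zippel (degree-pathDet depth) r₀ (λ det≡0 → 0≢1 (trans (sym det≡0) pathDet-r₀)) ⟩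
    d ℕ.* ∣ X ∣ ℕ.* q ℕ.^ E
      ≡⟨ cong (λ k → d ℕ.* k ℕ.* q ℕ.^ E) (subsetsOfSize-size X X∈) ⟩
    d ℕ.* k ℕ.* q ℕ.^ E ∎
    where
    open ℕ.≤-Reasoning
    ∣X∣≡∣Y∣ = trans (subsetsOfSize-size X X∈) (sym (subsetsOfSize-size Y Y∈))
    open PathMatrixFor X Y ∣X∣≡∣Y∣ using (degree-pathDet; r₀; pathDet-r₀)

  private
    singulars : Subset n × Subset m → ℕ
    singulars XY = count (singular? XY) (vectors E)

  singular-count-of-size : ∀ k →
    sum (map (λ XY → singulars XY ℕ.* q) (pairsOfSize k)) ≤ (n C k) ℕ.* (m C k) ℕ.* (d ℕ.* k) ℕ.* q ℕ.^ E
  singular-count-of-size k = begin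
    sum (map (λ XY → singulars XY ℕ.* q) (pairsOfSize k))
      ≤⟨ sum-map-mono (pairsOfSize k) (λ XY∈ → let X∈ , Y∈ = ∈-cartesianProduct⁻ _ _ XY∈ in singular-count X∈ Y∈) ⟩
    sum (map (λ _ → d ℕ.* k ℕ.* q ℕ.^ E) (pairsOfSize k))
      ≡⟨ sum-map-const (pairsOfSize k) (λ _ → refl) ⟩
    length (pairsOfSize k) ℕ.* (d ℕ.* k ℕ.* q ℕ.^ E)
      ≡⟨ cong (ℕ._* (d ℕ.* k ℕ.* q ℕ.^ E)) length-pairsOfSize ⟩
    (n C k) ℕ.* (m C k) ℕ.* (d ℕ.* k ℕ.* q ℕ.^ E)
      ≡⟨ ℕ.*-assoc ((n C k) ℕ.* (m C k)) (d ℕ.* k) (q ℕ.^ E) ⟨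
    (n C k) ℕ.* (m C k) ℕ.* (d ℕ.* k) ℕ.* q ℕ.^ E ∎
    where
    open ℕ.≤-Reasoning
    length-pairsOfSize : length (pairsOfSize k) ≡ (n C k) ℕ.* (m C k)
    length-pairsOfSize = trans (length-cartesianProductWith _,_ (subsetsOfSize n k) (subsetsOfSize m k))
                               (cong₂ ℕ._*_ (length-subsetsOfSize n k) (length-subsetsOfSize m k))

  nBad : ℕ
  nBad = count bad? (vectors E)

  length-good+nBad : length good ℕ.+ nBad ≡ q ℕ.^ E
  length-good+nBad = trans (ℕ.+-comm (length good) nBad)
                           (trans (count+count-∁≡length bad? (vectors E)) (length-vectors-size E))

  nBad*q≤ : nBad ℕ.* q ≤ sum (map (λ i → (n C i) ℕ.* (m C i) ℕ.* (d ℕ.* i)) (applyUpTo suc n)) ℕ.* q ℕ.^ E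
  nBad*q≤ = begin
    nBad ℕ.* q
      ≤⟨ ℕ.*-monoˡ-≤ q (count-any≤sum singular? pairs (vectors E)) ⟩
    sum (map singulars pairs) ℕ.* q
      ≡⟨ sum-map-*ʳ singulars q pairs ⟩
    sum (map (λ XY → singulars XY ℕ.* q) pairs)
      ≡⟨ sum-map-concatMap (λ XY → singulars XY ℕ.* q) pairsOfSize (applyUpTo suc n) ⟩
    sum (map (λ k → sum (map (λ XY → singulars XY ℕ.* q) (pairsOfSize k))) (applyUpTo suc n))
      ≤⟨ sum-map-mono (applyUpTo suc n) (λ {k} _ → singular-count-of-size k) ⟩
    sum (map (λ i → (n C i) ℕ.* (m C i) ℕ.* (d ℕ.* i) ℕ.* q ℕ.^ E) (applyUpTo suc n))
      ≡⟨ sum-map-*ʳ (λ i → (n C i) ℕ.* (m C i) ℕ.* (d ℕ.* i)) (q ℕ.^ E) (applyUpTo suc n) ⟨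
    sum (map (λ i → (n C i) ℕ.* (m C i) ℕ.* (d ℕ.* i)) (applyUpTo suc n)) ℕ.* q ℕ.^ E ∎
    where open ℕ.≤-Reasoning

open import Data.Nat using (ℕ; suc; _+_; _*_; _^_; _≤_)
open import Data.Nat.Combinatorics using (_C_)
open import Data.List using (List; length; map; applyUpTo)
open import Data.Nat.ListAction using (sum)
open import Data.List.Relation.Unary.All using (All)
open import Data.List.Relation.Unary.Unique.Propositional using (Unique)
open import Data.Vec using (Vec)
open import Data.Product using (Σ; _×_)

lemma5p4 : ∀ (𝔽 : FiniteField) (n m d : ℕ) (G : Graph n m) →
    IsSuperconcentrator G → HasDepth G d →
    Σ (List (Vec (FiniteField.Carrier 𝔽) (Graph.E G))) λ good →
      Unique good ×
      All (λ r → IsSICode 𝔽 (circuit 𝔽 G r)) good ×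
      (FiniteField.size 𝔽 ^ Graph.E G * FiniteField.size 𝔽
        ≤ length good * FiniteField.size 𝔽
          + sum (map (λ i → (n C i) * (m C i) * (d * i)) (applyUpTo suc n))
            * FiniteField.size 𝔽 ^ Graph.E G)
lemma5p4 𝔽 n m d G superconcentrator depth = good , good-unique , good-isSICode , (begin
  q ^ E * q                    ≡⟨ cong (_* q) length-good+nBad ⟨
  (length good + nBad) * q     ≡⟨ *-distribʳ-+ q (length good) nBad ⟩
  length good * q + nBad * q   ≤⟨ +-monoʳ-≤ (length good * q) nBad*q≤ ⟩
  length good * q + sum (map (λ i → (n C i) * (m C i) * (d * i)) (applyUpTo suc n)) * q ^ E ∎)
  where
  open Main 𝔽 G superconcentrator depth
  open Graph G using (E)
  open import Data.Nat.Properties using (*-distribʳ-+; +-monoʳ-≤; module ≤-Reasoning)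
  open import Data.Product using (_,_)
  open import Relation.Binary.PropositionalEquality using (cong)
  open ≤-Reasoning
  q = FiniteField.size 𝔽
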